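{- For any positive integers $n$ and $d$, $$\mathcal{C}_{n,d}(x)=\frac{1}{d!}\sum_{\sigma\in S_d}\ \prod_{c}\mathcal{C}_{n\cdot \ell(c)}(x),$$ where for each $\sigma$ the product runs over the cycles $c$ in the disjoint cycle decomposition of $\sigma$ (fixed points included as cycles of length $1$) and $\ell(c)$ is the length of $c$.
   Context: Graphs are finite multigraphs, possibly with loops. A matching of a graph $G$ is a set of edges, none of them loops, no two sharing an endpoint; $a(G,i)$ is the number of matchings with $i$ edges; for $G$ with $N$ vertices, $\mathcal{M}_G(x)=\sum_{i\ge0}(-1)^ia(G,i)x^{N-2i}$. $C_m$ has vertex set $\mathbb{Z}/m\mathbb{Z}$ and edges $e_i$ joining $i$ and $i+1$ for $i\in\mathbb{Z}/m\mathbb{Z}$; $\mathcal{C}_m=\mathcal{M}_{C_m}$. Permutations in $S_d$ act on $[d]$ on the right, $j\mapsto j^\sigma$. An $S_d$-labeling of $C_n$ is a tuple $\lambda=(\lambda(0^+),\dots,\lambda((n-1)^+))\in S_d^n$; $\mathcal{L}_d(C_n)$ is the set of these. The cover $C_{n,\lambda}$ has vertex set $\mathbb{Z}/n\mathbb{Z}\times[d]$ and, for each $i\in\mathbb{Z}/n\mathbb{Z}$, $j\in[d]$, an edge joining $(i,j)$ and $(i+1,j^{\lambda(i^+)})$. The $d$-matching polynomial of $C_n$ is $\mathcal{C}_{n,d}(x)=\frac{1}{|\mathcal{L}_d(C_n)|}\sum_{\lambda\in\mathcal{L}_d(C_n)}\mathcal{M}_{C_{n,\lambda}}(x)$. -}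

module Defs where

open import Data.Nat as ℕ using (ℕ; zero; suc; _∸_; _≡ᵇ_; _≤ᵇ_; _!)
open import Data.Nat.DivMod using (_mod_)
open import Data.Integer using (ℤ; +_)
open import Data.Fin using (Fin; toℕ)
import Data.Fin.Properties as FinP
open import Data.Bool using (Bool; true; false; _∧_; _∨_; not; if_then_else_)
open import Data.List using (List; []; _∷_; _++_; map; length; foldr; concatMap; allFin; upTo; filterᵇ)
open import Data.Bool.ListAction using (and; or)
open import Data.Vec using (Vec; lookup) renaming ([] to []ᵥ; _∷_ to _∷ᵥ_)
open import Data.Product using (_×_; _,_)
import Data.Product.Properties as ProdP
open import Data.Rational as ℚ using (ℚ; 0ℚ; 1ℚ; _/_)
open import Relation.Binary using (DecidableEquality)
open import Relation.Nullary.Decidable using (⌊_⌋)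

-- Polynomials in x with rational coefficients, as coefficient sequences:
-- p k is the coefficient of x^k.  (Only finitely many are nonzero for
-- everything built below.)  Equality of polynomials = equality of all
-- coefficients.

Poly : Set
Poly = ℕ → ℚ

mono : ℚ → ℕ → Poly
mono c e k = if e ≡ᵇ k then c else 0ℚ

poly0 : Poly
poly0 _ = 0ℚ

poly1 : Poly
poly1 = mono 1ℚ 0

_+P_ : Poly → Poly → Poly
(p +P q) k = p k ℚ.+ q k

_*P_ : Poly → Poly → Poly
(p *P q) k = foldr (λ a s → p a ℚ.* q (k ∸ a) ℚ.+ s) 0ℚ (upTo (suc k))

scaleP : ℚ → Poly → Poly
scaleP c p k = c ℚ.* p k

sumP : List Poly → Poly
sumP = foldr _+P_ poly0

prodP : List Poly → Poly
prodP = foldr _*P_ poly1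

ℕtoℚ : ℕ → ℚ
ℕtoℚ m = (+ m) / 1

-- 1/m for m > 0 (0 for m = 0, never used)
inv : ℕ → ℚ
inv zero    = 0ℚ
inv (suc m) = (+ 1) / suc m

sgn : ℕ → ℚ
sgn zero    = 1ℚ
sgn (suc i) = ℚ.- sgn i

-- Finite multigraphs (possibly with loops): a vertex type V with decidable
-- equality, its number of vertices N, and a list of edges (pairs of
-- endpoints; repeated entries = parallel edges, (v , v) = loop).

-- all sub-multisets of the edge list (chosen by position): 2^m of them
subs : ∀ {A : Set} → List A → List (List A)
subs []       = [] ∷ []
subs (x ∷ xs) = subs xs ++ map (x ∷_) (subs xs)

module _ {V : Set} (_≟V_ : DecidableEquality V) where

  _==_ : V → V → Bool
  u == v = ⌊ u ≟V v ⌋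

  notLoop : V × V → Bool
  notLoop (u , v) = not (u == v)

  disjoint : V × V → V × V → Bool
  disjoint (a , b) (c , d) = not ((a == c) ∨ (a == d) ∨ (b == c) ∨ (b == d))

  isMatching : List (V × V) → Bool
  isMatching []       = true
  isMatching (e ∷ es) = notLoop e ∧ and (map (disjoint e) es) ∧ isMatching es

  numMatchings : List (V × V) → ℕ → ℕ
  numMatchings E i =
    length (filterᵇ (λ M → isMatching M ∧ (length M ≡ᵇ i)) (subs E))

  -- M_G(x) = Σ_i (-1)^i a(G,i) x^(N-2i)   (a(G,i) = 0 for i > |E|)
  matchingPoly : (N : ℕ) → List (V × V) → Poly
  matchingPoly N E =
    sumP (map (λ i → mono (sgn i ℚ.* ℕtoℚ (numMatchings E i)) (N ∸ (i ℕ.+ i)))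
              (upTo (suc (length E))))

sucMod : ∀ {m} → Fin m → Fin m
sucMod {suc m} i = suc (toℕ i) mod suc m

-- the cycle C_m: vertices Z/mZ, edges e_i = {i, i+1}
cycleEdges : (m : ℕ) → List (Fin m × Fin m)
cycleEdges m = map (λ i → (i , sucMod i)) (allFin m)

cycPoly : ℕ → Poly
cycPoly m = matchingPoly FinP._≟_ m (cycleEdges m)

-- Permutations of [d] = Fin d, as vectors: j^σ = lookup σ j

tuples : ∀ {A : Set} → List A → (k : ℕ) → List (Vec A k)
tuples xs zero    = []ᵥ ∷ []
tuples xs (suc k) = concatMap (λ x → map (x ∷ᵥ_) (tuples xs k)) xs

Perm : ℕ → Set
Perm d = Vec (Fin d) d

_≡F_ : ∀ {d} → Fin d → Fin d → Bool
i ≡F j = ⌊ i FinP.≟ j ⌋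

isBijection : ∀ {d} → Perm d → Bool
isBijection {d} σ =
  and (map (λ i → and (map (λ j → not (lookup σ i ≡F lookup σ j) ∨ (i ≡F j)) (allFin d))) (allFin d))
  ∧ and (map (λ k → or (map (λ i → lookup σ i ≡F k) (allFin d))) (allFin d))

symGroup : (d : ℕ) → List (Perm d)
symGroup d = filterᵇ isBijection (tuples (allFin d) d)

-- 𝓛_d(C_n) = S_d^n ; λ(i⁺) = lookup λ i
labelings : (n d : ℕ) → List (Vec (Perm d) n)
labelings n d = tuples (symGroup d) n

-- edges of C_{n,λ}: (i,j) — (i+1, j^{λ(i⁺)})
coverEdges : ∀ {n d} → Vec (Perm d) n → List ((Fin n × Fin d) × (Fin n × Fin d))
coverEdges {n} {d} lab =
  concatMap (λ i → map (λ j → ((i , j) , (sucMod i , lookup (lookup lab i) j))) (allFin d))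
            (allFin n)

coverPoly : ∀ {n d} → Vec (Perm d) n → Poly
coverPoly {n} {d} lab =
  matchingPoly (ProdP.≡-dec FinP._≟_ FinP._≟_) (n ℕ.* d) (coverEdges lab)

dMatchingPoly : (n d : ℕ) → Poly
dMatchingPoly n d =
  scaleP (inv (length (labelings n d))) (sumP (map coverPoly (labelings n d)))

iter : ∀ {d} → Perm d → ℕ → Fin d → Fin d
iter σ zero    j = j
iter σ (suc k) j = lookup σ (iter σ k j)

-- first element of the list satisfying p (0 if none)
firstHit : (ℕ → Bool) → List ℕ → ℕ
firstHit p []       = 0
firstHit p (k ∷ ks) = if p k then k else firstHit p ks

-- length of the cycle of σ containing j: least k ≥ 1 with j^(σ^k) = j
-- (such k ≤ d always exists)
cycleLength : ∀ {d} → Perm d → Fin d → ℕ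
cycleLength {d} σ j = firstHit (λ k → iter σ k j ≡F j) (map suc (upTo d))

-- j is the representative (least element) of its cycle
isCycleRep : ∀ {d} → Perm d → Fin d → Bool
isCycleRep {d} σ j = and (map (λ k → toℕ j ≤ᵇ toℕ (iter σ k j)) (upTo d))

cycleType : ∀ {d} → Perm d → List ℕ
cycleType {d} σ = map (cycleLength σ) (filterᵇ (isCycleRep σ) (allFin d))

cycleFormula : (n d : ℕ) → Poly
cycleFormula n d =
  scaleP (inv (d !))
    (sumP (map (λ σ → prodP (map (λ l → cycPoly (n ℕ.* l)) (cycleType σ))) (symGroup d)))

module Submission where

-- For a labeling λ of C_n by permutations, put π = λ(0⁺) ⋯ λ((n-1)⁺).
-- Walking around the cover C_{n,λ} from (0 , j) returns to the first
-- sheet every n steps, having applied π; so the component through (0 , j) is a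
-- cycle of length n·ℓ(j), ℓ(j) the length of the π-cycle of j, and C_{n,λ} is
-- the disjoint union of the cycles C_{n·ℓ(c)} over the cycles c of π.  The
-- matching polynomial is invariant under relabelling vertices and
-- multiplicative over disjoint unions, hence M_{C_{n,λ}} = Π_c 𝒞_{n·ℓ(c)}
-- depends on λ only through π.  Finally λ ↦ π takes every value in S_d
-- exactly |S_d|^(n-1) times, and |S_d| = d!, which turns the average over
-- labelings into the average over S_d.

open import Defs
open import Data.Nat as ℕ using (ℕ; zero; suc; _∸_; _≡ᵇ_; _≤ᵇ_; _≤_; _<_; _≥_; _≤?_; s≤s; z≤n; z<s; NonZero; _!; _^_)
import Data.Nat.Properties as ℕP
open import Data.Nat.DivMod using (_%_; _/_; _mod_; m≡m%n+[m/n]*n; m%n<n; m<n*o⇒m/o<n; [m+kn]%n≡m%n; m<n⇒m%n≡m; %-distribˡ-+; m%n%n≡m%n)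
open import Data.Nat.Coprimality using (1-coprimeTo) renaming (sym to coprime-sym)
open import Data.Nat.ListAction using (sum)
open import Data.Nat.Tactic.RingSolver using (solve-∀)
import Data.Integer as ℤ
import Data.Integer.Properties as ℤP
open import Data.Rational using (ℚ; 0ℚ; 1ℚ; mkℚ; _+_; _*_; -_)
open import Data.Rational.Properties
  using (+-assoc; +-comm; +-identityˡ; +-identityʳ; *-assoc; *-comm; *-identityˡ; *-identityʳ; *-zeroˡ; *-zeroʳ;
         *-distribˡ-+; *-distribʳ-+; *-inverseʳ; neg-distribˡ-*; normalize-coprime)
open import Data.Bool using (Bool; true; false; if_then_else_; _∧_; _∨_; not; T)
open import Data.Bool.Properties using (∧-assoc; ∧-commutativeMonoid; ∨-commutativeMonoid)
open import Data.Bool.ListAction using (and; or)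
import Algebra.Solver.CommutativeMonoid as CMSolver
open import Data.List as List
  using (List; []; _∷_; _++_; map; length; foldr; concatMap; filterᵇ; upTo; applyUpTo; allFin; cartesianProduct)
import Data.List.Properties as ListP
open import Data.List.Membership.Propositional using (_∈_)
open import Data.List.Membership.Propositional.Properties
  using (∈-++⁻; ∈-++⁺ˡ; ∈-++⁺ʳ; ∈-map⁺; ∈-map⁻; ∈-upTo⁺; ∈-upTo⁻; ∈-lookup; ∈-allFin; ∈-filter⁺; ∈-filter⁻;
         ∈-concat⁺′; ∈-concat⁻′; ∈-cartesianProduct⁺)
open import Data.List.Membership.Propositional.Properties.WithK using (unique∧set⇒bag)
open import Data.List.Relation.Unary.Any using (here; there)
open import Data.List.Relation.Unary.All as All using (All; []; _∷_)
import Data.List.Relation.Unary.All.Properties as AllP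
open import Data.List.Relation.Unary.AllPairs as AllPairs using (AllPairs; []; _∷_)
import Data.List.Relation.Unary.AllPairs.Properties as AllPairsP
open import Data.List.Relation.Unary.Unique.Propositional using (Unique)
import Data.List.Relation.Unary.Unique.Propositional.Properties as UniqueP
open import Data.List.Relation.Binary.Disjoint.Propositional using (Disjoint)
open import Data.List.Relation.Binary.BagAndSetEquality using (∼bag⇒↭)
open import Data.List.Relation.Binary.Permutation.Propositional as ↭ using (_↭_)
import Data.List.Relation.Binary.Permutation.Propositional.Properties as ↭P
open import Data.Vec using (Vec; lookup; tabulate) renaming ([] to []ᵥ; _∷_ to _∷ᵥ_)
import Data.Vec.Properties as VecP
open import Data.Fin using (Fin; toℕ; fromℕ<; punchOut) renaming (zero to fzero; suc to fsuc)
import Data.Fin.Properties as FinP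
open import Data.Product using (_×_; _,_; proj₁; proj₂; ∃; ∃₂)
import Data.Product.Properties as ProdP
open import Data.Sum using (_⊎_; inj₁; inj₂)
open import Data.Empty using (⊥-elim)
open import Function using (_∘_)
open import Function.Bundles using (mk⇔)
open import Relation.Binary using (DecidableEquality)
open import Relation.Binary.Definitions using (tri<; tri≈; tri>)
open import Relation.Binary.PropositionalEquality
open import Relation.Nullary using (yes; no)
open import Relation.Nullary.Decidable using (T?)

Σ : {A : Set} → List A → (A → ℚ) → ℚ
Σ []       f = 0ℚ
Σ (x ∷ xs) f = f x + Σ xs f

+-interchange : ∀ a b c d → (a + b) + (c + d) ≡ (a + c) + (b + d)
+-interchange a b c d = begin
  (a + b) + (c + d) ≡⟨ +-assoc a b _ ⟩
  a + (b + (c + d)) ≡⟨ cong (a +_) (sym (+-assoc b c d)) ⟩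
  a + ((b + c) + d) ≡⟨ cong (λ z → a + (z + d)) (+-comm b c) ⟩
  a + ((c + b) + d) ≡⟨ cong (a +_) (+-assoc c b d) ⟩
  a + (c + (b + d)) ≡⟨ sym (+-assoc a c _) ⟩
  (a + c) + (b + d) ∎
  where open ≡-Reasoning

module _ {A : Set} where

  Σ-congIn : (xs : List A) {f g : A → ℚ} → (∀ {x} → x ∈ xs → f x ≡ g x) → Σ xs f ≡ Σ xs g
  Σ-congIn []       e = refl
  Σ-congIn (x ∷ xs) e = cong₂ _+_ (e (here refl)) (Σ-congIn xs (e ∘ there))

  Σ-cong : (xs : List A) {f g : A → ℚ} → (∀ x → f x ≡ g x) → Σ xs f ≡ Σ xs g
  Σ-cong xs e = Σ-congIn xs (λ {x} _ → e x)

  Σ-++ : (xs ys : List A) (f : A → ℚ) → Σ (xs ++ ys) f ≡ Σ xs f + Σ ys f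
  Σ-++ []       ys f = sym (+-identityˡ _)
  Σ-++ (x ∷ xs) ys f = trans (cong (f x +_) (Σ-++ xs ys f)) (sym (+-assoc (f x) _ _))

  Σ-zero : (xs : List A) → Σ xs (λ _ → 0ℚ) ≡ 0ℚ
  Σ-zero []       = refl
  Σ-zero (x ∷ xs) = trans (+-identityˡ _) (Σ-zero xs)

  Σ-+ : (xs : List A) (f g : A → ℚ) → Σ xs (λ x → f x + g x) ≡ Σ xs f + Σ xs g
  Σ-+ []       f g = sym (+-identityˡ _)
  Σ-+ (x ∷ xs) f g =
    trans (cong ((f x + g x) +_) (Σ-+ xs f g)) (+-interchange (f x) (g x) _ _)

  Σ-*ˡ : (c : ℚ) (xs : List A) (f : A → ℚ) → c * Σ xs f ≡ Σ xs (λ x → c * f x)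
  Σ-*ˡ c []       f = *-zeroʳ c
  Σ-*ˡ c (x ∷ xs) f = trans (*-distribˡ-+ c (f x) _) (cong (c * f x +_) (Σ-*ˡ c xs f))

  Σ-*ʳ : (c : ℚ) (xs : List A) (f : A → ℚ) → Σ xs f * c ≡ Σ xs (λ x → f x * c)
  Σ-*ʳ c xs f = trans (*-comm _ c) (trans (Σ-*ˡ c xs f) (Σ-cong xs (λ x → *-comm c (f x))))

  Σ-↭ : {xs ys : List A} (f : A → ℚ) → xs ↭ ys → Σ xs f ≡ Σ ys f
  Σ-↭ f ↭.refl          = refl
  Σ-↭ f (↭.prep x p)    = cong (f x +_) (Σ-↭ f p)
  Σ-↭ f (↭.swap x y p)  = begin
    f x + (f y + _) ≡⟨ sym (+-assoc (f x) _ _) ⟩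
    (f x + f y) + _ ≡⟨ cong₂ _+_ (+-comm (f x) (f y)) (Σ-↭ f p) ⟩
    (f y + f x) + _ ≡⟨ +-assoc (f y) _ _ ⟩
    f y + (f x + _) ∎
    where open ≡-Reasoning
  Σ-↭ f (↭.trans p q)   = trans (Σ-↭ f p) (Σ-↭ f q)

module _ {A B : Set} where

  Σ-map : (g : A → B) (xs : List A) (f : B → ℚ) → Σ (map g xs) f ≡ Σ xs (f ∘ g)
  Σ-map g []       f = refl
  Σ-map g (x ∷ xs) f = cong (f (g x) +_) (Σ-map g xs f)

  Σ-swap : (xs : List A) (ys : List B) (f : A → B → ℚ) →
    Σ xs (λ x → Σ ys (f x)) ≡ Σ ys (λ y → Σ xs (λ x → f x y))
  Σ-swap []       ys f = sym (Σ-zero ys)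
  Σ-swap (x ∷ xs) ys f =
    trans (cong (Σ ys (f x) +_) (Σ-swap xs ys f)) (sym (Σ-+ ys (f x) (λ y → Σ xs (λ x → f x y))))

  Σ-concatMap : (g : A → List B) (xs : List A) (f : B → ℚ) →
    Σ (concatMap g xs) f ≡ Σ xs (λ x → Σ (g x) f)
  Σ-concatMap g []       f = refl
  Σ-concatMap g (x ∷ xs) f =
    trans (Σ-++ (g x) _ f) (cong (Σ (g x) f +_) (Σ-concatMap g xs f))

ℕtoℚ-suc : ∀ m → ℕtoℚ (suc m) ≡ 1ℚ + ℕtoℚ m
ℕtoℚ-suc m = sym (trans (cong (1ℚ +_) (normalize-coprime (coprime-sym (1-coprimeTo m))))
                       (cong (λ z → (ℤ.+ 1 ℤ.+ z) Data.Rational./ 1) (ℤP.*-identityʳ (ℤ.+ m))))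

ℕtoℚ-+ : ∀ a b → ℕtoℚ (a ℕ.+ b) ≡ ℕtoℚ a + ℕtoℚ b
ℕtoℚ-+ zero    b = sym (+-identityˡ (ℕtoℚ b))
ℕtoℚ-+ (suc a) b = begin
  ℕtoℚ (suc (a ℕ.+ b))       ≡⟨ ℕtoℚ-suc (a ℕ.+ b) ⟩
  1ℚ + ℕtoℚ (a ℕ.+ b)        ≡⟨ cong (1ℚ +_) (ℕtoℚ-+ a b) ⟩
  1ℚ + (ℕtoℚ a + ℕtoℚ b)     ≡⟨ sym (+-assoc 1ℚ (ℕtoℚ a) (ℕtoℚ b)) ⟩
  (1ℚ + ℕtoℚ a) + ℕtoℚ b     ≡⟨ cong (_+ ℕtoℚ b) (sym (ℕtoℚ-suc a)) ⟩
  ℕtoℚ (suc a) + ℕtoℚ b      ∎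
  where open ≡-Reasoning

ℕtoℚ-* : ∀ a b → ℕtoℚ (a ℕ.* b) ≡ ℕtoℚ a * ℕtoℚ b
ℕtoℚ-* zero    b = sym (*-zeroˡ (ℕtoℚ b))
ℕtoℚ-* (suc a) b = begin
  ℕtoℚ (b ℕ.+ a ℕ.* b)              ≡⟨ ℕtoℚ-+ b (a ℕ.* b) ⟩
  ℕtoℚ b + ℕtoℚ (a ℕ.* b)           ≡⟨ cong₂ _+_ (sym (*-identityˡ (ℕtoℚ b))) (ℕtoℚ-* a b) ⟩
  1ℚ * ℕtoℚ b + ℕtoℚ a * ℕtoℚ b     ≡⟨ sym (*-distribʳ-+ (ℕtoℚ b) 1ℚ (ℕtoℚ a)) ⟩
  (1ℚ + ℕtoℚ a) * ℕtoℚ b            ≡⟨ cong (_* ℕtoℚ b) (sym (ℕtoℚ-suc a)) ⟩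
  ℕtoℚ (suc a) * ℕtoℚ b             ∎
  where open ≡-Reasoning

ℕtoℚ-*-inv : ∀ m .{{_ : NonZero m}} → ℕtoℚ m * inv m ≡ 1ℚ
ℕtoℚ-*-inv m@(suc _)
  rewrite normalize-coprime (coprime-sym (1-coprimeTo m))
        | normalize-coprime (1-coprimeTo m)
  = *-inverseʳ (mkℚ (ℤ.+ m) 0 (coprime-sym (1-coprimeTo m)))

inv-cancel : ∀ a b .{{_ : NonZero a}} .{{_ : NonZero b}} (X : ℚ) → inv (a ℕ.* b) * (ℕtoℚ b * X) ≡ inv a * X
inv-cancel a@(suc _) b@(suc _) X = trans (sym (*-assoc I B X)) (cong (_* X) I*B≡inv-a)
  where
  open ≡-Reasoning
  A = ℕtoℚ a
  B = ℕtoℚ b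
  I = inv (a ℕ.* b)
  A*I*B≡1 : A * (I * B) ≡ 1ℚ
  A*I*B≡1 = begin
    A * (I * B)          ≡⟨ cong (A *_) (*-comm I B) ⟩
    A * (B * I)          ≡⟨ sym (*-assoc A B I) ⟩
    (A * B) * I          ≡⟨ cong (_* I) (sym (ℕtoℚ-* a b)) ⟩
    ℕtoℚ (a ℕ.* b) * I   ≡⟨ ℕtoℚ-*-inv (a ℕ.* b) ⟩
    1ℚ                   ∎
  I*B≡inv-a : I * B ≡ inv a
  I*B≡inv-a = begin
    I * B                   ≡⟨ sym (*-identityˡ _) ⟩
    1ℚ * (I * B)            ≡⟨ cong (_* (I * B)) (sym (trans (*-comm (inv a) A) (ℕtoℚ-*-inv a))) ⟩
    (inv a * A) * (I * B)   ≡⟨ *-assoc (inv a) A _ ⟩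
    inv a * (A * (I * B))   ≡⟨ cong (inv a *_) A*I*B≡1 ⟩
    inv a * 1ℚ              ≡⟨ *-identityʳ _ ⟩
    inv a                   ∎

module _ {A : Set} where

  Σ-const : (xs : List A) (c : ℚ) → Σ xs (λ _ → c) ≡ ℕtoℚ (length xs) * c
  Σ-const []       c = sym (*-zeroˡ c)
  Σ-const (x ∷ xs) c = begin
    c + Σ xs (λ _ → c)                  ≡⟨ cong₂ _+_ (sym (*-identityˡ c)) (Σ-const xs c) ⟩
    1ℚ * c + ℕtoℚ (length xs) * c       ≡⟨ sym (*-distribʳ-+ c 1ℚ (ℕtoℚ (length xs))) ⟩
    (1ℚ + ℕtoℚ (length xs)) * c         ≡⟨ cong (_* c) (sym (ℕtoℚ-suc (length xs))) ⟩
    ℕtoℚ (suc (length xs)) * c          ∎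
    where open ≡-Reasoning

  length-filter-Σ : (p : A → Bool) (xs : List A) →
    ℕtoℚ (length (filterᵇ p xs)) ≡ Σ xs (λ x → if p x then 1ℚ else 0ℚ)
  length-filter-Σ p []       = refl
  length-filter-Σ p (x ∷ xs) with p x
  ... | true  = trans (ℕtoℚ-suc (length (filterᵇ p xs))) (cong (1ℚ +_) (length-filter-Σ p xs))
  ... | false = trans (length-filter-Σ p xs) (sym (+-identityˡ _))

≡ᵇ-refl : ∀ m → (m ≡ᵇ m) ≡ true
≡ᵇ-refl zero    = refl
≡ᵇ-refl (suc m) = ≡ᵇ-refl m

≡⇒≡ᵇ : ∀ {m n} → m ≡ n → (m ≡ᵇ n) ≡ true
≡⇒≡ᵇ {m} refl = ≡ᵇ-refl m

≡ᵇ⇒≡ : ∀ {m n} → (m ≡ᵇ n) ≡ true → m ≡ n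
≡ᵇ⇒≡ {m} {n} e = ℕP.≡ᵇ⇒≡ m n (subst T (sym e) _)

≢⇒≡ᵇ : ∀ {m n} → m ≢ n → (m ≡ᵇ n) ≡ false
≢⇒≡ᵇ {m} {n} m≢n with m ≡ᵇ n in eq
... | true  = ⊥-elim (m≢n (≡ᵇ⇒≡ eq))
... | false = refl

≡ᵇ-equiv : ∀ {m n m′ n′} → (m ≡ n → m′ ≡ n′) → (m′ ≡ n′ → m ≡ n) → (m ≡ᵇ n) ≡ (m′ ≡ᵇ n′)
≡ᵇ-equiv {m} {n} {m′} {n′} to from with m ≡ᵇ n in e | m′ ≡ᵇ n′ in e′
... | true  | true  = refl
... | false | false = refl
... | true  | false = sym (trans (sym e′) (≡⇒≡ᵇ (to (≡ᵇ⇒≡ e))))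
... | false | true  = trans (sym e) (≡⇒≡ᵇ (from (≡ᵇ⇒≡ e′)))

sumP-coeff : (ps : List Poly) (k : ℕ) → sumP ps k ≡ Σ ps (λ p → p k)
sumP-coeff []       k = refl
sumP-coeff (p ∷ ps) k = cong (p k +_) (sumP-coeff ps k)

*P-coeff : (p q : Poly) (k : ℕ) → (p *P q) k ≡ Σ (upTo (suc k)) (λ a → p a * q (k ∸ a))
*P-coeff p q k = foldr-Σ (upTo (suc k))
  where
  foldr-Σ : (as : List ℕ) → foldr (λ a s → p a * q (k ∸ a) + s) 0ℚ as ≡ Σ as (λ a → p a * q (k ∸ a))
  foldr-Σ []       = refl
  foldr-Σ (a ∷ as) = cong (p a * q (k ∸ a) +_) (foldr-Σ as)

*P-cong : {p p′ q q′ : Poly} → (∀ k → p k ≡ p′ k) → (∀ k → q k ≡ q′ k) →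
  ∀ k → (p *P q) k ≡ (p′ *P q′) k
*P-cong {p} {p′} {q} {q′} p≗p′ q≗q′ k = begin
  (p *P q) k                                 ≡⟨ *P-coeff p q k ⟩
  Σ (upTo (suc k)) (λ a → p a * q (k ∸ a))   ≡⟨ Σ-cong (upTo (suc k)) (λ a → cong₂ _*_ (p≗p′ a) (q≗q′ (k ∸ a))) ⟩
  Σ (upTo (suc k)) (λ a → p′ a * q′ (k ∸ a)) ≡⟨ sym (*P-coeff p′ q′ k) ⟩
  (p′ *P q′) k                               ∎
  where open ≡-Reasoning

prodP-cong : {A : Set} (F G : A → Poly) (xs : List A) → (∀ {a} → a ∈ xs → ∀ k → F a k ≡ G a k) →
  ∀ k → prodP (map F xs) k ≡ prodP (map G xs) k
prodP-cong F G []       F≗G k = refl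
prodP-cong F G (x ∷ xs) F≗G k = *P-cong (F≗G (here refl)) (prodP-cong F G xs (F≗G ∘ there)) k

Σ-upTo-suc : (m : ℕ) (f : ℕ → ℚ) → Σ (upTo (suc m)) f ≡ Σ (upTo m) f + f m
Σ-upTo-suc m f = begin
  Σ (upTo (suc m)) f                ≡⟨ cong (λ is → Σ is f) (sym (ListP.upTo-∷ʳ m)) ⟩
  Σ (upTo m ++ m ∷ []) f            ≡⟨ Σ-++ (upTo m) (m ∷ []) f ⟩
  Σ (upTo m) f + (f m + 0ℚ)         ≡⟨ cong (Σ (upTo m) f +_) (+-identityʳ (f m)) ⟩
  Σ (upTo m) f + f m                ∎
  where open ≡-Reasoning

Σ-delta : (m j : ℕ) (G : ℕ → ℚ) → j < m → Σ (upTo m) (λ i → if j ≡ᵇ i then G i else 0ℚ) ≡ G j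
Σ-delta (suc m) j G j<1+m =
  trans (Σ-upTo-suc m δ) (last-or-earlier (ℕP.m≤n⇒m<n∨m≡n (ℕP.≤-pred j<1+m)))
  where
  δ = λ i → if j ≡ᵇ i then G i else 0ℚ
  δ-off : ∀ {i} → j ≢ i → δ i ≡ 0ℚ
  δ-off j≢i rewrite ≢⇒≡ᵇ j≢i = refl
  last-or-earlier : (j < m) ⊎ (j ≡ m) → Σ (upTo m) δ + δ m ≡ G j
  last-or-earlier (inj₁ j<m) = begin
    Σ (upTo m) δ + δ m ≡⟨ cong₂ _+_ (Σ-delta m j G j<m) (δ-off (ℕP.<⇒≢ j<m)) ⟩
    G j + 0ℚ           ≡⟨ +-identityʳ (G j) ⟩
    G j                ∎
    where open ≡-Reasoning
  last-or-earlier (inj₂ refl) = begin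
    Σ (upTo j) δ + δ j ≡⟨ cong₂ _+_ (trans (Σ-congIn (upTo j) (λ i∈ → δ-off (ℕP.>⇒≢ (∈-upTo⁻ i∈))))
                                             (Σ-zero (upTo j)))
                                      (cong (λ b → if b then G j else 0ℚ) (≡ᵇ-refl j)) ⟩
    0ℚ + G j           ≡⟨ +-identityˡ (G j) ⟩
    G j                ∎
    where open ≡-Reasoning

monomial-product : ∀ e₁ e₂ k (c₁ c₂ : ℚ) →
  Σ (upTo (suc k)) (λ a → (if e₁ ≡ᵇ a then c₁ else 0ℚ) * (if e₂ ≡ᵇ (k ∸ a) then c₂ else 0ℚ)) ≡
  (if (e₁ ℕ.+ e₂) ≡ᵇ k then c₁ * c₂ else 0ℚ)
monomial-product e₁ e₂ k c₁ c₂ with e₁ ℕ.≤? k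
... | yes e₁≤k = begin
  Σ (upTo (suc k)) (λ a → (if e₁ ≡ᵇ a then c₁ else 0ℚ) * G a) ≡⟨ Σ-cong (upTo (suc k)) select ⟩
  Σ (upTo (suc k)) (λ a → if e₁ ≡ᵇ a then c₁ * G a else 0ℚ) ≡⟨ Σ-delta (suc k) e₁ (λ a → c₁ * G a) (s≤s e₁≤k) ⟩
  c₁ * G e₁                                                 ≡⟨ scale (e₂ ≡ᵇ (k ∸ e₁)) ⟩
  (if e₂ ≡ᵇ (k ∸ e₁) then c₁ * c₂ else 0ℚ)                  ≡⟨ cong (λ b → if b then c₁ * c₂ else 0ℚ) degrees ⟩
  (if (e₁ ℕ.+ e₂) ≡ᵇ k then c₁ * c₂ else 0ℚ)                ∎
  where
  open ≡-Reasoning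
  G = λ a → if e₂ ≡ᵇ (k ∸ a) then c₂ else 0ℚ
  select : ∀ a → (if e₁ ≡ᵇ a then c₁ else 0ℚ) * G a ≡ (if e₁ ≡ᵇ a then c₁ * G a else 0ℚ)
  select a with e₁ ≡ᵇ a
  ... | true  = refl
  ... | false = *-zeroˡ (G a)
  scale : ∀ b → c₁ * (if b then c₂ else 0ℚ) ≡ (if b then c₁ * c₂ else 0ℚ)
  scale true  = refl
  scale false = *-zeroʳ c₁
  degrees : (e₂ ≡ᵇ (k ∸ e₁)) ≡ ((e₁ ℕ.+ e₂) ≡ᵇ k)
  degrees = ≡ᵇ-equiv (λ e → trans (cong (e₁ ℕ.+_) e) (ℕP.m+[n∸m]≡n e₁≤k))
                     (λ e → sym (trans (cong (_∸ e₁) (sym e)) (ℕP.m+n∸m≡n e₁ e₂)))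
... | no e₁≰k = begin
  Σ (upTo (suc k)) (λ a → (if e₁ ≡ᵇ a then c₁ else 0ℚ) * (if e₂ ≡ᵇ (k ∸ a) then c₂ else 0ℚ))
                                              ≡⟨ Σ-congIn (upTo (suc k)) vanish ⟩
  Σ (upTo (suc k)) (λ _ → 0ℚ)                 ≡⟨ Σ-zero (upTo (suc k)) ⟩
  0ℚ                                          ≡⟨ cong (λ b → if b then c₁ * c₂ else 0ℚ)
                                                      (sym (≢⇒≡ᵇ (λ e → e₁≰k (subst (e₁ ≤_) e (ℕP.m≤m+n e₁ e₂))))) ⟩
  (if (e₁ ℕ.+ e₂) ≡ᵇ k then c₁ * c₂ else 0ℚ)  ∎
  where
  open ≡-Reasoning
  vanish : ∀ {a} → a ∈ upTo (suc k) → (if e₁ ≡ᵇ a then c₁ else 0ℚ) * (if e₂ ≡ᵇ (k ∸ a) then c₂ else 0ℚ) ≡ 0ℚ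
  vanish {a} a∈ rewrite ≢⇒≡ᵇ {e₁} {a} (λ e → e₁≰k (subst (ℕ._≤ k) (sym e) (ℕP.≤-pred (∈-upTo⁻ a∈)))) =
    *-zeroˡ (if e₂ ≡ᵇ (k ∸ a) then c₂ else 0ℚ)

module _ {A : Set} where

  Σ-subs-∷ : (x : A) (xs : List A) (f : List A → ℚ) →
    Σ (subs (x ∷ xs)) f ≡ Σ (subs xs) f + Σ (subs xs) (f ∘ (x ∷_))
  Σ-subs-∷ x xs f = trans (Σ-++ (subs xs) _ f) (cong (Σ (subs xs) f +_) (Σ-map (x ∷_) (subs xs) f))

  Σ-subs-↭ : {E E′ : List A} (f : List A → ℚ) → (∀ {M M′} → M ↭ M′ → f M ≡ f M′) →
    E ↭ E′ → Σ (subs E) f ≡ Σ (subs E′) f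
  Σ-subs-↭ f f-inv ↭.refl = refl
  Σ-subs-↭ {x ∷ xs} {x ∷ ys} f f-inv (↭.prep x p) = begin
    Σ (subs (x ∷ xs)) f                                ≡⟨ Σ-subs-∷ x xs f ⟩
    Σ (subs xs) f + Σ (subs xs) (f ∘ (x ∷_))           ≡⟨ cong₂ _+_ (Σ-subs-↭ f f-inv p)
                                                               (Σ-subs-↭ (f ∘ (x ∷_)) (f-inv ∘ ↭.prep x) p) ⟩
    Σ (subs ys) f + Σ (subs ys) (f ∘ (x ∷_))           ≡⟨ sym (Σ-subs-∷ x ys f) ⟩
    Σ (subs (x ∷ ys)) f                                ∎
    where open ≡-Reasoning
  Σ-subs-↭ {x ∷ y ∷ xs} {y ∷ x ∷ ys} f f-inv (↭.swap x y p) = begin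
    Σ (subs (x ∷ y ∷ xs)) f                            ≡⟨ expand x y xs ⟩
    (S xs f + S xs (f ∘ (y ∷_))) + (S xs (f ∘ (x ∷_)) + S xs (f ∘ (x ∷_) ∘ (y ∷_)))
                                                       ≡⟨ +-interchange (S xs f) (S xs (f ∘ (y ∷_))) (S xs (f ∘ (x ∷_))) _ ⟩
    (S xs f + S xs (f ∘ (x ∷_))) + (S xs (f ∘ (y ∷_)) + S xs (f ∘ (x ∷_) ∘ (y ∷_)))
                                                       ≡⟨ cong₂ _+_ (cong₂ _+_ (Σ-subs-↭ f f-inv p)
                                                                               (Σ-subs-↭ (f ∘ (x ∷_)) (f-inv ∘ ↭.prep x) p))
                                                                    (cong₂ _+_ (Σ-subs-↭ (f ∘ (y ∷_)) (f-inv ∘ ↭.prep y) p)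
                                                                               swapped) ⟩
    (S ys f + S ys (f ∘ (x ∷_))) + (S ys (f ∘ (y ∷_)) + S ys (f ∘ (y ∷_) ∘ (x ∷_)))
                                                       ≡⟨ sym (expand y x ys) ⟩
    Σ (subs (y ∷ x ∷ ys)) f                            ∎
    where
    open ≡-Reasoning
    S = λ zs (g : List A → ℚ) → Σ (subs zs) g
    expand : ∀ u v zs → Σ (subs (u ∷ v ∷ zs)) f ≡
      (S zs f + S zs (f ∘ (v ∷_))) + (S zs (f ∘ (u ∷_)) + S zs (f ∘ (u ∷_) ∘ (v ∷_)))
    expand u v zs = trans (Σ-subs-∷ u (v ∷ zs) f) (cong₂ _+_ (Σ-subs-∷ v zs f) (Σ-subs-∷ v zs (f ∘ (u ∷_))))
    swapped : S xs (f ∘ (x ∷_) ∘ (y ∷_)) ≡ S ys (f ∘ (y ∷_) ∘ (x ∷_))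
    swapped = trans (Σ-subs-↭ (f ∘ (x ∷_) ∘ (y ∷_)) (f-inv ∘ ↭.prep x ∘ ↭.prep y) p)
                    (Σ-cong (subs ys) (λ M → f-inv (↭.swap x y ↭.refl)))
  Σ-subs-↭ f f-inv (↭.trans p q) = trans (Σ-subs-↭ f f-inv p) (Σ-subs-↭ f f-inv q)

  Σ-subs-++ : (E₁ E₂ : List A) (f : List A → ℚ) →
    Σ (subs (E₁ ++ E₂)) f ≡ Σ (subs E₁) (λ M₁ → Σ (subs E₂) (λ M₂ → f (M₁ ++ M₂)))
  Σ-subs-++ []       E₂ f = sym (+-identityʳ _)
  Σ-subs-++ (x ∷ E₁) E₂ f = begin
    Σ (subs (x ∷ E₁ ++ E₂)) f                                    ≡⟨ Σ-subs-∷ x (E₁ ++ E₂) f ⟩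
    Σ (subs (E₁ ++ E₂)) f + Σ (subs (E₁ ++ E₂)) (f ∘ (x ∷_))     ≡⟨ cong₂ _+_ (Σ-subs-++ E₁ E₂ f)
                                                                             (Σ-subs-++ E₁ E₂ (f ∘ (x ∷_))) ⟩
    _                                                            ≡⟨ sym (Σ-subs-∷ x E₁ _) ⟩
    Σ (subs (x ∷ E₁)) (λ M₁ → Σ (subs E₂) (λ M₂ → f (M₁ ++ M₂))) ∎
    where open ≡-Reasoning

  subs-++⁻ : (E₁ E₂ : List A) {M : List A} → M ∈ subs (E₁ ++ E₂) →
    ∃₂ λ M₁ M₂ → M₁ ∈ subs E₁ × M₂ ∈ subs E₂ × M ≡ M₁ ++ M₂
  subs-++⁻ []       E₂ {M} M∈ = [] , M , here refl , M∈ , refl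
  subs-++⁻ (x ∷ E₁) E₂ M∈ with ∈-++⁻ (subs (E₁ ++ E₂)) M∈
  ... | inj₁ M∈′ with subs-++⁻ E₁ E₂ M∈′
  ...   | M₁ , M₂ , M₁∈ , M₂∈ , eq = M₁ , M₂ , ∈-++⁺ˡ M₁∈ , M₂∈ , eq
  subs-++⁻ (x ∷ E₁) E₂ M∈ | inj₂ xM∈ with ∈-map⁻ (x ∷_) xM∈
  ... | M′ , M′∈ , refl with subs-++⁻ E₁ E₂ M′∈
  ...   | M₁ , M₂ , M₁∈ , M₂∈ , refl =
          x ∷ M₁ , M₂ , ∈-++⁺ʳ (subs E₁) (∈-map⁺ (x ∷_) M₁∈) , M₂∈ , refl

  subs-⊆ : {E M : List A} → M ∈ subs E → ∀ {e} → e ∈ M → e ∈ E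
  subs-⊆ {[]}    (here refl) ()
  subs-⊆ {x ∷ E} M∈ e∈ with ∈-++⁻ (subs E) M∈
  ... | inj₁ M∈′ = there (subs-⊆ M∈′ e∈)
  ... | inj₂ xM∈ with ∈-map⁻ (x ∷_) xM∈
  ...   | M′ , M′∈ , refl with e∈
  ...     | here refl = here refl
  ...     | there e∈′ = there (subs-⊆ M′∈ e∈′)

  subs-length : {E M : List A} → M ∈ subs E → length M ≤ length E
  subs-length {[]}    (here refl) = z≤n
  subs-length {x ∷ E} M∈ with ∈-++⁻ (subs E) M∈
  ... | inj₁ M∈′ = ℕP.m≤n⇒m≤1+n (subs-length {E = E} M∈′)
  ... | inj₂ xM∈ with ∈-map⁻ (x ∷_) xM∈
  ...   | M′ , M′∈ , refl = s≤s (subs-length {E = E} M′∈)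

module _ {A B : Set} where

  subs-map : (h : A → B) (E : List A) → subs (map h E) ≡ map (map h) (subs E)
  subs-map h []      = refl
  subs-map h (x ∷ E) = begin
    subs (map h E) ++ map (h x ∷_) (subs (map h E))
      ≡⟨ cong (λ S → S ++ map (h x ∷_) S) (subs-map h E) ⟩
    map (map h) (subs E) ++ map (h x ∷_) (map (map h) (subs E))
      ≡⟨ cong (map (map h) (subs E) ++_) (trans (sym (ListP.map-∘ (subs E))) (ListP.map-∘ (subs E))) ⟩
    map (map h) (subs E) ++ map (map h) (map (x ∷_) (subs E))
      ≡⟨ sym (ListP.map-++ (map h) (subs E) _) ⟩
    map (map h) (subs E ++ map (x ∷_) (subs E)) ∎
    where open ≡-Reasoning

  Σ-subs-map : (h : A → B) (E : List A) (f : List B → ℚ) →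
    Σ (subs (map h E)) f ≡ Σ (subs E) (f ∘ map h)
  Σ-subs-map h E f = trans (cong (λ S → Σ S f) (subs-map h E)) (Σ-map (map h) (subs E) f)

sgn-+ : ∀ a b → sgn (a ℕ.+ b) ≡ sgn a * sgn b
sgn-+ zero    b = sym (*-identityˡ (sgn b))
sgn-+ (suc a) b = trans (cong -_ (sgn-+ a b)) (neg-distribˡ-* (sgn a) (sgn b))

∧-exchange : ∀ a b c → a ∧ (b ∧ c) ≡ b ∧ (a ∧ c)
∧-exchange = solve 3 (λ a b c → a ⊕ (b ⊕ c) ⊜ b ⊕ (a ⊕ c)) refl
  where open CMSolver ∧-commutativeMonoid

∧-swap-pairs : ∀ a b c d e f → a ∧ (b ∧ c) ∧ (d ∧ e ∧ f) ≡ d ∧ (b ∧ e) ∧ (a ∧ c ∧ f)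
∧-swap-pairs = solve 6 (λ a b c d e f → a ⊕ (b ⊕ c) ⊕ (d ⊕ e ⊕ f) ⊜ d ⊕ (b ⊕ e) ⊕ (a ⊕ c ⊕ f)) refl
  where open CMSolver ∧-commutativeMonoid

∧-regroup : ∀ a b c d → a ∧ (b ∧ true) ∧ (c ∧ d) ≡ (a ∧ b ∧ c) ∧ d
∧-regroup = solve 4 (λ a b c d → a ⊕ (b ⊕ id) ⊕ (c ⊕ d) ⊜ (a ⊕ b ⊕ c) ⊕ d) refl
  where open CMSolver ∧-commutativeMonoid

∨-exchange : ∀ x y z w → x ∨ y ∨ z ∨ w ≡ x ∨ z ∨ y ∨ w
∨-exchange = solve 4 (λ x y z w → x ⊕ y ⊕ z ⊕ w ⊜ x ⊕ z ⊕ y ⊕ w) refl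
  where open CMSolver ∨-commutativeMonoid

∧-true⁻ : ∀ {a b} → a ∧ b ≡ true → (a ≡ true) × (b ≡ true)
∧-true⁻ {true} {true} _ = refl , refl

and-map-↭ : {A : Set} (f : A → Bool) {xs ys : List A} → xs ↭ ys → and (map f xs) ≡ and (map f ys)
and-map-↭ f ↭.refl         = refl
and-map-↭ f (↭.prep x p)   = cong (f x ∧_) (and-map-↭ f p)
and-map-↭ f (↭.swap x y p) =
  trans (∧-exchange (f x) (f y) _)
        (cong (λ z → f y ∧ f x ∧ z) (and-map-↭ f p))
and-map-↭ f (↭.trans p q)  = trans (and-map-↭ f p) (and-map-↭ f q)

and-map-++ : {A : Set} (f : A → Bool) (xs ys : List A) →
  and (map f (xs ++ ys)) ≡ and (map f xs) ∧ and (map f ys)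
and-map-++ f []       ys = refl
and-map-++ f (x ∷ xs) ys =
  trans (cong (f x ∧_) (and-map-++ f xs ys)) (sym (∧-assoc (f x) _ _))

and-map-true : {A : Set} (f : A → Bool) (xs : List A) → (∀ {x} → x ∈ xs → f x ≡ true) →
  and (map f xs) ≡ true
and-map-true f []       all-true = refl
and-map-true f (x ∷ xs) all-true rewrite all-true (here refl) = and-map-true f xs (all-true ∘ there)

and-map-true⁻ : {A : Set} (f : A → Bool) (xs : List A) → and (map f xs) ≡ true →
  ∀ {x} → x ∈ xs → f x ≡ true
and-map-true⁻ f (y ∷ xs) h (here refl) = proj₁ (∧-true⁻ h)
and-map-true⁻ f (y ∷ xs) h (there x∈)  = and-map-true⁻ f xs (proj₂ (∧-true⁻ h)) x∈

-- The coefficients of the matching polynomial as a sum over all edge subsets: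
-- the subset M contributes (-1)^|M| to the coefficient of x^(N-2|M|) when M is
-- a matching, and nothing otherwise.  In this form the polynomial is easy to
-- compare across graphs: the summand is local to M.
module Matchings {V : Set} (_≟V_ : DecidableEquality V) where

  isM : List (V × V) → Bool
  isM = isMatching _≟V_

  disj : V × V → V × V → Bool
  disj = disjoint _≟V_

  _==V_ : V → V → Bool
  _==V_ = _==_ _≟V_

  weight : ℕ → ℕ → List (V × V) → ℚ
  weight N k M = if isM M then (if (N ∸ (length M ℕ.+ length M)) ≡ᵇ k then sgn (length M) else 0ℚ) else 0ℚ

  coeffSum : ℕ → List (V × V) → Poly
  coeffSum N E k = Σ (subs E) (weight N k)

  -- grouping the subsets by size recovers Σ_i (-1)^i a(G,i) x^(N-2i)
  matchingPoly-coeff : (N : ℕ) (E : List (V × V)) (k : ℕ) → matchingPoly _≟V_ N E k ≡ coeffSum N E k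
  matchingPoly-coeff N E k = begin
    matchingPoly _≟V_ N E k                         ≡⟨ sumP-coeff (map term sizes) k ⟩
    Σ (map term sizes) (λ p → p k)                  ≡⟨ Σ-map term sizes (λ p → p k) ⟩
    Σ sizes (λ i → term i k)                        ≡⟨ Σ-cong sizes count-by-subsets ⟩
    Σ sizes (λ i → Σ (subs E) (sized i))            ≡⟨ Σ-swap sizes (subs E) sized ⟩
    Σ (subs E) (λ M → Σ sizes (λ i → sized i M))    ≡⟨ Σ-congIn (subs E) collapse ⟩
    Σ (subs E) (weight N k)                         ∎
    where
    open ≡-Reasoning
    sizes = upTo (suc (length E))
    term : ℕ → Poly
    term i = mono (sgn i Data.Rational.* ℕtoℚ (numMatchings _≟V_ E i)) (N ∸ (i ℕ.+ i))
    sized : ℕ → List (V × V) → ℚ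
    sized i M = if (N ∸ (i ℕ.+ i)) ≡ᵇ k then (if isM M ∧ (length M ≡ᵇ i) then sgn i else 0ℚ) else 0ℚ
    count-by-subsets : ∀ i → term i k ≡ Σ (subs E) (sized i)
    count-by-subsets i with (N ∸ (i ℕ.+ i)) ≡ᵇ k
    ... | false = sym (Σ-zero (subs E))
    ... | true  = begin
      sgn i * ℕtoℚ (numMatchings _≟V_ E i)        ≡⟨ cong (sgn i *_) (length-filter-Σ _ (subs E)) ⟩
      sgn i * Σ (subs E) _                         ≡⟨ Σ-*ˡ (sgn i) (subs E) _ ⟩
      Σ (subs E) _                                 ≡⟨ Σ-cong (subs E) scale-indicator ⟩
      Σ (subs E) (λ M → if isM M ∧ (length M ≡ᵇ i) then sgn i else 0ℚ) ∎
      where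
      scale-indicator : ∀ M → sgn i * (if isM M ∧ (length M ≡ᵇ i) then 1ℚ else 0ℚ)
                                ≡ (if isM M ∧ (length M ≡ᵇ i) then sgn i else 0ℚ)
      scale-indicator M with isM M ∧ (length M ≡ᵇ i)
      ... | true  = *-identityʳ (sgn i)
      ... | false = *-zeroʳ (sgn i)
    -- only the size i = |M| contributes
    at-size : List (V × V) → ℕ → ℚ
    at-size M i = if (N ∸ (i ℕ.+ i)) ≡ᵇ k then (if isM M then sgn i else 0ℚ) else 0ℚ
    sized-delta : ∀ M i → sized i M ≡ (if length M ≡ᵇ i then at-size M i else 0ℚ)
    sized-delta M i with (N ∸ (i ℕ.+ i)) ≡ᵇ k | isM M | length M ≡ᵇ i
    ... | true  | true  | true  = refl
    ... | true  | true  | false = refl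
    ... | true  | false | true  = refl
    ... | true  | false | false = refl
    ... | false | _     | true  = refl
    ... | false | _     | false = refl
    at-own-size : ∀ M → at-size M (length M) ≡ weight N k M
    at-own-size M with (N ∸ (length M ℕ.+ length M)) ≡ᵇ k | isM M
    ... | true  | true  = refl
    ... | true  | false = refl
    ... | false | true  = refl
    ... | false | false = refl
    collapse : ∀ {M} → M ∈ subs E → Σ sizes (λ i → sized i M) ≡ weight N k M
    collapse {M} M∈ = begin
      Σ sizes (λ i → sized i M)                                    ≡⟨ Σ-cong sizes (sized-delta M) ⟩
      Σ sizes (λ i → if length M ≡ᵇ i then at-size M i else 0ℚ)    ≡⟨ Σ-delta (suc (length E)) (length M) (at-size M)
                                                                         (s≤s (subs-length {E = E} M∈)) ⟩
      at-size M (length M)                                         ≡⟨ at-own-size M ⟩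
      weight N k M                                                 ∎

  ==V-sym : ∀ u v → (u ==V v) ≡ (v ==V u)
  ==V-sym u v with u ≟V v | v ≟V u
  ... | yes _   | yes _   = refl
  ... | yes u≡v | no v≢u  = ⊥-elim (v≢u (sym u≡v))
  ... | no u≢v  | yes v≡u = ⊥-elim (u≢v (sym v≡u))
  ... | no _    | no _    = refl

  disj-sym : ∀ e e′ → disj e e′ ≡ disj e′ e
  disj-sym (a , b) (c , d)
    rewrite ==V-sym a c | ==V-sym a d | ==V-sym b c | ==V-sym b d =
    cong not (∨-exchange (c ==V a) (d ==V a) (c ==V b) (d ==V b))

  ≢⇒==V-false : ∀ {u v} → u ≢ v → (u ==V v) ≡ false
  ≢⇒==V-false {u} {v} u≢v with u ≟V v
  ... | yes u≡v = ⊥-elim (u≢v u≡v)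
  ... | no _    = refl

  disj-intro : ∀ {a b c d} → a ≢ c → a ≢ d → b ≢ c → b ≢ d → disj (a , b) (c , d) ≡ true
  disj-intro a≢c a≢d b≢c b≢d
    rewrite ≢⇒==V-false a≢c | ≢⇒==V-false a≢d | ≢⇒==V-false b≢c | ≢⇒==V-false b≢d = refl

  isM-↭ : {M M′ : List (V × V)} → M ↭ M′ → isM M ≡ isM M′
  isM-↭ ↭.refl = refl
  isM-↭ (↭.prep e p) = cong₂ (λ u v → notLoop _≟V_ e ∧ u ∧ v) (and-map-↭ (disj e) p) (isM-↭ p)
  isM-↭ {x ∷ y ∷ xs} {y ∷ x ∷ ys} (↭.swap x y p) = begin
    lx ∧ (disj x y ∧ and (map (disj x) xs)) ∧ (ly ∧ and (map (disj y) xs) ∧ isM xs)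
      ≡⟨ ∧-swap-pairs lx (disj x y) (and (map (disj x) xs)) ly (and (map (disj y) xs)) (isM xs) ⟩
    ly ∧ (disj x y ∧ and (map (disj y) xs)) ∧ (lx ∧ and (map (disj x) xs) ∧ isM xs)
      ≡⟨ cong₄ (λ u v w z → ly ∧ (u ∧ v) ∧ (lx ∧ w ∧ z))
               (disj-sym x y) (and-map-↭ (disj y) p) (and-map-↭ (disj x) p) (isM-↭ p) ⟩
    ly ∧ (disj y x ∧ and (map (disj y) ys)) ∧ (lx ∧ and (map (disj x) ys) ∧ isM ys) ∎
    where
    open ≡-Reasoning
    lx = notLoop _≟V_ x
    ly = notLoop _≟V_ y
    cong₄ : ∀ {a b c d : Bool} {a′ b′ c′ d′ : Bool} (f : Bool → Bool → Bool → Bool → Bool) →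
      a ≡ a′ → b ≡ b′ → c ≡ c′ → d ≡ d′ → f a b c d ≡ f a′ b′ c′ d′
    cong₄ f refl refl refl refl = refl
  isM-↭ (↭.trans p q) = trans (isM-↭ p) (isM-↭ q)

  coeffSum-↭ : ∀ N {E E′} → E ↭ E′ → ∀ k → coeffSum N E k ≡ coeffSum N E′ k
  coeffSum-↭ N E↭E′ k = Σ-subs-↭ (weight N k) weight-↭ E↭E′
    where
    weight-↭ : ∀ {M M′} → M ↭ M′ → weight N k M ≡ weight N k M′
    weight-↭ M↭M′ rewrite isM-↭ M↭M′ | ↭P.↭-length M↭M′ = refl

  Cross : List (V × V) → List (V × V) → Set
  Cross E₁ E₂ = ∀ {e₁ e₂} → e₁ ∈ E₁ → e₂ ∈ E₂ → disj e₁ e₂ ≡ true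

  Cross-subs : {E₁ E₂ M₁ M₂ : List (V × V)} → Cross E₁ E₂ → M₁ ∈ subs E₁ → M₂ ∈ subs E₂ → Cross M₁ M₂
  Cross-subs cross M₁∈ M₂∈ e₁∈ e₂∈ = cross (subs-⊆ M₁∈ e₁∈) (subs-⊆ M₂∈ e₂∈)

  isM-++ : (M₁ M₂ : List (V × V)) → Cross M₁ M₂ → isM (M₁ ++ M₂) ≡ isM M₁ ∧ isM M₂
  isM-++ []       M₂ cross = refl
  isM-++ (e ∷ M₁) M₂ cross = begin
    l ∧ and (map (disj e) (M₁ ++ M₂)) ∧ isM (M₁ ++ M₂)
      ≡⟨ cong₂ (λ u v → l ∧ u ∧ v) (and-map-++ (disj e) M₁ M₂) (isM-++ M₁ M₂ (cross ∘ there)) ⟩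
    l ∧ (and (map (disj e) M₁) ∧ and (map (disj e) M₂)) ∧ (isM M₁ ∧ isM M₂)
      ≡⟨ cong (λ u → l ∧ (and (map (disj e) M₁) ∧ u) ∧ (isM M₁ ∧ isM M₂))
              (and-map-true (disj e) M₂ (cross (here refl))) ⟩
    l ∧ (and (map (disj e) M₁) ∧ true) ∧ (isM M₁ ∧ isM M₂)
      ≡⟨ ∧-regroup l (and (map (disj e) M₁)) (isM M₁) (isM M₂) ⟩
    (l ∧ and (map (disj e) M₁) ∧ isM M₁) ∧ isM M₂ ∎
    where
    open ≡-Reasoning
    l = notLoop _≟V_ e

  Bounded : ℕ → List (V × V) → Set
  Bounded N E = ∀ {M} → M ∈ subs E → isM M ≡ true → length M ℕ.+ length M ≤ N

  Bounded-++ : ∀ {N₁ N₂ E₁ E₂} → Cross E₁ E₂ → Bounded N₁ E₁ → Bounded N₂ E₂ →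
    Bounded (N₁ ℕ.+ N₂) (E₁ ++ E₂)
  Bounded-++ {N₁} {N₂} {E₁} {E₂} cross b₁ b₂ M∈ M-matching with subs-++⁻ E₁ E₂ M∈
  ... | M₁ , M₂ , M₁∈ , M₂∈ , refl
    with ∧-true⁻ (trans (sym (isM-++ M₁ M₂ (Cross-subs cross M₁∈ M₂∈))) M-matching)
  ...   | M₁-matching , M₂-matching =
    subst (ℕ._≤ N₁ ℕ.+ N₂)
          (sym (trans (cong (λ z → z ℕ.+ z) (ListP.length-++ M₁)) (regroup (length M₁) (length M₂))))
          (ℕP.+-mono-≤ (b₁ M₁∈ M₁-matching) (b₂ M₂∈ M₂-matching))
    where
    regroup : ∀ a b → (a ℕ.+ b) ℕ.+ (a ℕ.+ b) ≡ (a ℕ.+ a) ℕ.+ (b ℕ.+ b)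
    regroup = solve-∀

  -- The degree N - 2|M| is additive over disjoint unions, as long as no
  -- truncated subtraction occurs.
  degree-++ : ∀ N₁ N₂ l₁ l₂ → l₁ ℕ.+ l₁ ≤ N₁ → l₂ ℕ.+ l₂ ≤ N₂ →
    (N₁ ℕ.+ N₂) ∸ ((l₁ ℕ.+ l₂) ℕ.+ (l₁ ℕ.+ l₂)) ≡ (N₁ ∸ (l₁ ℕ.+ l₁)) ℕ.+ (N₂ ∸ (l₂ ℕ.+ l₂))
  degree-++ N₁ N₂ l₁ l₂ b₁ b₂ = begin
    (N₁ ℕ.+ N₂) ∸ L                                     ≡⟨ cong (_∸ L) (cong₂ ℕ._+_ (sym (ℕP.m+[n∸m]≡n b₁))
                                                                                   (sym (ℕP.m+[n∸m]≡n b₂))) ⟩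
    ((l₁ ℕ.+ l₁) ℕ.+ e₁ ℕ.+ ((l₂ ℕ.+ l₂) ℕ.+ e₂)) ∸ L   ≡⟨ cong (_∸ L) (regroup l₁ l₂ e₁ e₂) ⟩
    (L ℕ.+ (e₁ ℕ.+ e₂)) ∸ L                             ≡⟨ ℕP.m+n∸m≡n L (e₁ ℕ.+ e₂) ⟩
    e₁ ℕ.+ e₂                                           ∎
    where
    open ≡-Reasoning
    L = (l₁ ℕ.+ l₂) ℕ.+ (l₁ ℕ.+ l₂)
    e₁ = N₁ ∸ (l₁ ℕ.+ l₁)
    e₂ = N₂ ∸ (l₂ ℕ.+ l₂)
    regroup : ∀ a b x y → (a ℕ.+ a) ℕ.+ x ℕ.+ ((b ℕ.+ b) ℕ.+ y) ≡ ((a ℕ.+ b) ℕ.+ (a ℕ.+ b)) ℕ.+ (x ℕ.+ y)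
    regroup = solve-∀

  -- The matching polynomial of a vertex-disjoint union is the product of the
  -- matching polynomials: a matching of E₁ ++ E₂ is a pair of matchings.
  coeffSum-++ : ∀ N₁ N₂ (E₁ E₂ : List (V × V)) → Cross E₁ E₂ → Bounded N₁ E₁ → Bounded N₂ E₂ →
    ∀ k → coeffSum (N₁ ℕ.+ N₂) (E₁ ++ E₂) k ≡ (coeffSum N₁ E₁ *P coeffSum N₂ E₂) k
  coeffSum-++ N₁ N₂ E₁ E₂ cross b₁ b₂ k = begin
    coeffSum (N₁ ℕ.+ N₂) (E₁ ++ E₂) k
      ≡⟨ Σ-subs-++ E₁ E₂ _ ⟩
    Σ (subs E₁) (λ M₁ → Σ (subs E₂) (λ M₂ → weight (N₁ ℕ.+ N₂) k (M₁ ++ M₂)))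
      ≡⟨ Σ-congIn (subs E₁) (λ M₁∈ → Σ-congIn (subs E₂) (λ M₂∈ → split M₁∈ M₂∈)) ⟩
    Σ (subs E₁) (λ M₁ → Σ (subs E₂) (λ M₂ → Σ U (λ a → weight N₁ a M₁ * weight N₂ (k ∸ a) M₂)))
      ≡⟨ Σ-cong (subs E₁) (λ M₁ → Σ-swap (subs E₂) U _) ⟩
    Σ (subs E₁) (λ M₁ → Σ U (λ a → Σ (subs E₂) (λ M₂ → weight N₁ a M₁ * weight N₂ (k ∸ a) M₂)))
      ≡⟨ Σ-swap (subs E₁) U _ ⟩
    Σ U (λ a → Σ (subs E₁) (λ M₁ → Σ (subs E₂) (λ M₂ → weight N₁ a M₁ * weight N₂ (k ∸ a) M₂)))
      ≡⟨ Σ-cong U (λ a → trans (Σ-cong (subs E₁) (λ M₁ → sym (Σ-*ˡ (weight N₁ a M₁) (subs E₂) _)))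
                               (sym (Σ-*ʳ _ (subs E₁) _))) ⟩
    Σ U (λ a → coeffSum N₁ E₁ a * coeffSum N₂ E₂ (k ∸ a))
      ≡⟨ sym (*P-coeff (coeffSum N₁ E₁) (coeffSum N₂ E₂) k) ⟩
    (coeffSum N₁ E₁ *P coeffSum N₂ E₂) k ∎
    where
    open ≡-Reasoning
    U = upTo (suc k)
    split : ∀ {M₁ M₂} → M₁ ∈ subs E₁ → M₂ ∈ subs E₂ →
      weight (N₁ ℕ.+ N₂) k (M₁ ++ M₂) ≡ Σ U (λ a → weight N₁ a M₁ * weight N₂ (k ∸ a) M₂)
    split {M₁} {M₂} M₁∈ M₂∈ with isM M₁ in M₁?
    ... | false rewrite isM-++ M₁ M₂ (Cross-subs cross M₁∈ M₂∈) | M₁? =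
      sym (trans (Σ-cong U (λ a → *-zeroˡ (weight N₂ (k ∸ a) M₂))) (Σ-zero U))
    ... | true with isM M₂ in M₂?
    ...   | false rewrite isM-++ M₁ M₂ (Cross-subs cross M₁∈ M₂∈) | M₁? | M₂? =
      sym (trans (Σ-cong U (λ a → *-zeroʳ (if (N₁ ∸ (length M₁ ℕ.+ length M₁)) ≡ᵇ a then sgn (length M₁) else 0ℚ)))
                 (Σ-zero U))
    ...   | true rewrite isM-++ M₁ M₂ (Cross-subs cross M₁∈ M₂∈) | M₁? | M₂? = begin
      (if (N₁ ℕ.+ N₂ ∸ (length (M₁ ++ M₂) ℕ.+ length (M₁ ++ M₂))) ≡ᵇ k then sgn (length (M₁ ++ M₂)) else 0ℚ)
        ≡⟨ cong₂ (λ e s → if e ≡ᵇ k then s else 0ℚ)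
             (trans (cong (λ z → N₁ ℕ.+ N₂ ∸ (z ℕ.+ z)) (ListP.length-++ M₁))
                    (degree-++ N₁ N₂ (length M₁) (length M₂) (b₁ M₁∈ M₁?) (b₂ M₂∈ M₂?)))
             (trans (cong sgn (ListP.length-++ M₁)) (sgn-+ (length M₁) (length M₂))) ⟩
      (if (e₁ ℕ.+ e₂) ≡ᵇ k then sgn (length M₁) * sgn (length M₂) else 0ℚ)
        ≡⟨ sym (monomial-product e₁ e₂ k (sgn (length M₁)) (sgn (length M₂))) ⟩
      Σ U (λ a → (if e₁ ≡ᵇ a then sgn (length M₁) else 0ℚ) * (if e₂ ≡ᵇ (k ∸ a) then sgn (length M₂) else 0ℚ)) ∎
      where
      e₁ = N₁ ∸ (length M₁ ℕ.+ length M₁)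
      e₂ = N₂ ∸ (length M₂ ℕ.+ length M₂)

module Relabel {V U : Set} (_≟V_ : DecidableEquality V) (_≟U_ : DecidableEquality U)
               (g : V → U) (g-inj : ∀ {u v} → g u ≡ g v → u ≡ v) where
  private
    module MV = Matchings _≟V_
    module MU = Matchings _≟U_

  gEdge : V × V → U × U
  gEdge (u , v) = (g u , g v)

  ==-relabel : ∀ u v → (g u MU.==V g v) ≡ (u MV.==V v)
  ==-relabel u v with g u ≟U g v | u ≟V v
  ... | yes _  | yes _  = refl
  ... | yes e  | no u≢v = ⊥-elim (u≢v (g-inj e))
  ... | no g≢  | yes refl = ⊥-elim (g≢ refl)
  ... | no _   | no _   = refl

  isM-relabel : ∀ M → MU.isM (map gEdge M) ≡ MV.isM M
  isM-relabel [] = refl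
  isM-relabel ((a , b) ∷ M) rewrite ==-relabel a b | isM-relabel M =
    cong (λ z → not (a MV.==V b) ∧ z ∧ MV.isM M)
         (trans (cong and (sym (ListP.map-∘ M))) (cong and (ListP.map-cong disj-relabel M)))
    where
    disj-relabel : ∀ e → MU.disj (gEdge (a , b)) (gEdge e) ≡ MV.disj (a , b) e
    disj-relabel (c , d) rewrite ==-relabel a c | ==-relabel a d | ==-relabel b c | ==-relabel b d = refl

  coeffSum-relabel : ∀ N E k → MU.coeffSum N (map gEdge E) k ≡ MV.coeffSum N E k
  coeffSum-relabel N E k =
    trans (Σ-subs-map gEdge E (MU.weight N k)) (Σ-cong (subs E) weight-relabel)
    where
    weight-relabel : ∀ M → MU.weight N k (map gEdge M) ≡ MV.weight N k M
    weight-relabel M rewrite isM-relabel M | ListP.length-map gEdge M = refl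

  Bounded-relabel : ∀ {N E} → MV.Bounded N E → MU.Bounded N (map gEdge E)
  Bounded-relabel {N} {E} bound {M} M∈ M-matching rewrite subs-map gEdge E with ∈-map⁻ (map gEdge) M∈
  ... | M′ , M′∈ , refl rewrite ListP.length-map gEdge M′ =
    bound M′∈ (trans (sym (isM-relabel M′)) M-matching)

lookup-injective : {A : Set} {xs : List A} → AllPairs _≢_ xs → ∀ {i j} → List.lookup xs i ≡ List.lookup xs j → i ≡ j
lookup-injective (_  ∷ _)  {fzero}  {fzero}  _ = refl
lookup-injective (x≢ ∷ _)  {fzero}  {fsuc j} e = ⊥-elim (All.lookup x≢ (∈-lookup j) e)
lookup-injective (x≢ ∷ _)  {fsuc i} {fzero}  e = ⊥-elim (All.lookup x≢ (∈-lookup i) (sym e))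
lookup-injective (_  ∷ ps) {fsuc i} {fsuc j} e = cong fsuc (lookup-injective ps e)

nor₄ : ∀ {p q r s} → not (p ∨ q ∨ r ∨ s) ≡ true → (p ≡ false) × (q ≡ false) × (r ≡ false) × (s ≡ false)
nor₄ {false} {false} {false} {false} _ = refl , refl , refl , refl

module _ {V : Set} (_≟V_ : DecidableEquality V) where
  open Matchings _≟V_

  endpoints : List (V × V) → List V
  endpoints []            = []
  endpoints ((u , v) ∷ M) = u ∷ v ∷ endpoints M

  endpoints-length : ∀ M → length (endpoints M) ≡ length M ℕ.+ length M
  endpoints-length []      = refl
  endpoints-length (e ∷ M) =
    cong suc (trans (cong suc (endpoints-length M)) (sym (ℕP.+-suc (length M) (length M))))

  ==V-false : ∀ {u v} → (u ==V v) ≡ false → u ≢ v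
  ==V-false {u} {v} e with u ≟V v
  ... | no u≢v = u≢v

  disj-endpoints : ∀ u v M → and (map (disj (u , v)) M) ≡ true →
    All (λ w → (u ≢ w) × (v ≢ w)) (endpoints M)
  disj-endpoints u v []            _ = []
  disj-endpoints u v ((a , b) ∷ M) h with ∧-true⁻ h
  ... | h₁ , h₂ with nor₄ {u ==V a} {u ==V b} {v ==V a} {v ==V b} h₁
  ...   | ua , ub , va , vb =
    (==V-false ua , ==V-false va) ∷ (==V-false ub , ==V-false vb) ∷ disj-endpoints u v M h₂

  matching-endpoints-distinct : ∀ M → isM M ≡ true → AllPairs _≢_ (endpoints M)
  matching-endpoints-distinct []            _ = []
  matching-endpoints-distinct ((u , v) ∷ M) h with ∧-true⁻ h
  ... | notLoop-uv , h₂ with ∧-true⁻ h₂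
  ... | disj-M , M-matching =
    (u≢v ∷ All.map proj₁ avoid) ∷ All.map proj₂ avoid ∷ matching-endpoints-distinct M M-matching
    where
    avoid = disj-endpoints u v M disj-M
    u≢v : u ≢ v
    u≢v = ==V-false (not-true notLoop-uv)
      where
      not-true : ∀ {b} → not b ≡ true → b ≡ false
      not-true {false} _ = refl

Fin-Bounded : (m : ℕ) (E : List (Fin m × Fin m)) → Matchings.Bounded FinP._≟_ m E
Fin-Bounded m E {M} _ M-matching =
  subst (_≤ m) (endpoints-length FinP._≟_ M)
    (FinP.injective⇒≤ (lookup-injective (matching-endpoints-distinct FinP._≟_ M M-matching)))

module _ {V : Set} (_≟V_ : DecidableEquality V) where
  open Matchings _≟V_

  Cross-concat : {A : Set} (E : A → List (V × V)) {E₀ : List (V × V)} (xs : List A) →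
    All (λ a → Cross E₀ (E a)) xs → Cross E₀ (concatMap E xs)
  Cross-concat E xs crosses e₁∈ e₂∈ with ∈-concat⁻′ (map E xs) e₂∈
  ... | _ , e₂∈Ea , Ea∈ with ∈-map⁻ E Ea∈
  ...   | a , a∈ , refl = All.lookup crosses a∈ e₁∈ e₂∈Ea

  Bounded-concat : {A : Set} (N : A → ℕ) (E : A → List (V × V)) (xs : List A) →
    AllPairs (λ a b → Cross (E a) (E b)) xs → All (λ a → Bounded (N a) (E a)) xs →
    Bounded (sum (map N xs)) (concatMap E xs)
  Bounded-concat N E []       _          _          (here refl) _ = ℕ.z≤n
  Bounded-concat N E (x ∷ xs) (cx ∷ cxs) (bx ∷ bxs) =
    Bounded-++ (Cross-concat E xs cx) bx (Bounded-concat N E xs cxs bxs)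

  coeffSum-concat : {A : Set} (N : A → ℕ) (E : A → List (V × V)) (xs : List A) →
    AllPairs (λ a b → Cross (E a) (E b)) xs → All (λ a → Bounded (N a) (E a)) xs →
    ∀ k → coeffSum (sum (map N xs)) (concatMap E xs) k ≡ prodP (map (λ a → coeffSum (N a) (E a)) xs) k
  coeffSum-concat N E []       _          _          k = +-identityʳ _
  coeffSum-concat N E (x ∷ xs) (cx ∷ cxs) (bx ∷ bxs) k =
    trans (coeffSum-++ (N x) (sum (map N xs)) (E x) (concatMap E xs)
                       (Cross-concat E xs cx) bx (Bounded-concat N E xs cxs bxs) k)
          (*P-cong {p = coeffSum (N x) (E x)} (λ _ → refl) (coeffSum-concat N E xs cxs bxs) k)

T⇒≡true : ∀ {b} → T b → b ≡ true
T⇒≡true {true} _ = refl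

≡F⇒≡ : ∀ {d} {a b : Fin d} → (a ≡F b) ≡ true → a ≡ b
≡F⇒≡ {d} {a} {b} e with a FinP.≟ b
... | yes a≡b = a≡b

≡F-false⇒≢ : ∀ {d} {a b : Fin d} → (a ≡F b) ≡ false → a ≢ b
≡F-false⇒≢ {d} {a} {b} e with a FinP.≟ b
... | no a≢b = a≢b

≡F-refl : ∀ {d} (a : Fin d) → (a ≡F a) ≡ true
≡F-refl a with a FinP.≟ a
... | yes _   = refl
... | no a≢a = ⊥-elim (a≢a refl)

firstHit-spec : (p : ℕ → Bool) (f : ℕ → ℕ) (m i : ℕ) → i < m → p (f i) ≡ true →
  ∃ λ i₀ → i₀ < m × firstHit p (applyUpTo f m) ≡ f i₀ × p (f i₀) ≡ true × (∀ i′ → i′ < i₀ → p (f i′) ≡ false)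
firstHit-spec p f (suc m) i i<m hit with p (f 0) in p₀
... | true = 0 , z<s , refl , p₀ , (λ _ ())
... | false with i
...   | zero = ⊥-elim (false≢true (trans (sym p₀) hit))
  where
  false≢true : false ≢ true
  false≢true ()
...   | suc i′ with firstHit-spec p (f ∘ suc) m i′ (ℕP.≤-pred i<m) hit
...     | i₀ , i₀<m , first , hit₀ , misses =
          suc i₀ , s≤s i₀<m , first , hit₀ , λ { zero _ → p₀ ; (suc i″) (s≤s i″<i₀) → misses i″ i″<i₀ }

argmin : (f : ℕ → ℕ) (m : ℕ) → 0 < m → ∃ λ k₀ → k₀ < m × (∀ k → k < m → f k₀ ≤ f k)
argmin f (suc zero) _ = 0 , z<s , λ { zero _ → ℕP.≤-refl ; (suc k) (s≤s ()) }
argmin f (suc (suc m)) _ with argmin f (suc m) z<s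
... | k₀ , k₀<m , k₀-min with f k₀ ≤? f (suc m)
...   | yes fk₀≤ = k₀ , ℕP.m≤n⇒m≤1+n k₀<m , λ k k< → min (ℕP.m≤n⇒m<n∨m≡n (ℕP.≤-pred k<))
  where
  min : ∀ {k} → (k < suc m) ⊎ (k ≡ suc m) → f k₀ ≤ f k
  min (inj₁ k<m) = k₀-min _ k<m
  min (inj₂ refl) = fk₀≤
...   | no fk₀≰ = suc m , ℕP.n<1+n (suc m) , λ k k< → min (ℕP.m≤n⇒m<n∨m≡n (ℕP.≤-pred k<))
  where
  min : ∀ {k} → (k < suc m) ⊎ (k ≡ suc m) → f (suc m) ≤ f k
  min (inj₁ k<m) = ℕP.≤-trans (ℕP.<⇒≤ (ℕP.≰⇒> fk₀≰)) (k₀-min _ k<m)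
  min (inj₂ refl) = ℕP.≤-refl

Injective : ∀ {d} → Perm d → Set
Injective σ = ∀ {a b} → lookup σ a ≡ lookup σ b → a ≡ b

module Orbits {d : ℕ} (σ : Perm d) (σ-inj : Injective σ) where

  σ^ : ℕ → Fin d → Fin d
  σ^ = iter σ

  σ^-+ : ∀ a b j → σ^ (a ℕ.+ b) j ≡ σ^ a (σ^ b j)
  σ^-+ zero    b j = refl
  σ^-+ (suc a) b j = cong (lookup σ) (σ^-+ a b j)

  σ^-injective : ∀ a {x y} → σ^ a x ≡ σ^ a y → x ≡ y
  σ^-injective zero    e = e
  σ^-injective (suc a) e = σ^-injective a (σ-inj e)

  -- by pigeonhole some power 1 ≤ c ≤ d fixes j
  returns : (j : Fin d) → ∃ λ c → 0 < c × c ≤ d × σ^ c j ≡ j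
  returns j with FinP.pigeonhole (ℕP.n<1+n d) (λ (i : Fin (suc d)) → σ^ (toℕ i) j)
  ... | i , i′ , i<i′ , σⁱ≡σⁱ′ =
    c , ℕP.m<n⇒0<n∸m i<i′ , ℕP.≤-trans (ℕP.m∸n≤m (toℕ i′) (toℕ i)) (ℕP.≤-pred (FinP.toℕ<n i′)) , σᶜ≡id
    where
    c = toℕ i′ ∸ toℕ i
    σᶜ≡id : σ^ c j ≡ j
    σᶜ≡id = σ^-injective (toℕ i) (begin
      σ^ (toℕ i) (σ^ c j) ≡⟨ sym (σ^-+ (toℕ i) c j) ⟩
      σ^ (toℕ i ℕ.+ c) j  ≡⟨ cong (λ z → σ^ z j) (ℕP.m+[n∸m]≡n (ℕP.<⇒≤ i<i′)) ⟩
      σ^ (toℕ i′) j       ≡⟨ sym σⁱ≡σⁱ′ ⟩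
      σ^ (toℕ i) j        ∎)
      where open ≡-Reasoning

  ℓ : Fin d → ℕ
  ℓ = cycleLength σ

  ℓ-spec : ∀ j → ∃ λ i₀ → i₀ < d × ℓ j ≡ suc i₀ × σ^ (suc i₀) j ≡ j × (∀ i′ → i′ < i₀ → σ^ (suc i′) j ≢ j)
  ℓ-spec j with returns j
  ... | suc c′ , _ , c≤d , σᶜ≡id
    with firstHit-spec (λ k → iter σ k j ≡F j) suc d c′ c≤d (subst (λ z → (z ≡F j) ≡ true) (sym σᶜ≡id) (≡F-refl j))
  ...   | i₀ , i₀<d , first , hit , misses =
    i₀ , i₀<d , trans (cong (firstHit (λ k → iter σ k j ≡F j)) (ListP.map-upTo suc d)) first ,
    ≡F⇒≡ hit , λ i′ i′<i₀ → ≡F-false⇒≢ (misses i′ i′<i₀)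

  ℓ-positive : ∀ j → 0 < ℓ j
  ℓ-positive j with ℓ-spec j
  ... | i₀ , _ , ℓ≡ , _ = subst (0 <_) (sym ℓ≡) z<s

  instance
    ℓ-nonZero : ∀ {j} → NonZero (ℓ j)
    ℓ-nonZero {j} = ℕ.>-nonZero (ℓ-positive j)

  ℓ≤d : ∀ j → ℓ j ≤ d
  ℓ≤d j with ℓ-spec j
  ... | i₀ , i₀<d , ℓ≡ , _ = subst (_≤ d) (sym ℓ≡) i₀<d

  σ^ℓ : ∀ j → σ^ (ℓ j) j ≡ j
  σ^ℓ j with ℓ-spec j
  ... | i₀ , _ , ℓ≡ , fixes , _ = subst (λ z → σ^ z j ≡ j) (sym ℓ≡) fixes

  ℓ-minimal : ∀ j k → 0 < k → k < ℓ j → σ^ k j ≢ j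
  ℓ-minimal j (suc k) _ k<ℓ with ℓ-spec j
  ... | i₀ , _ , ℓ≡ , _ , misses = misses k (ℕP.≤-pred (subst (suc k <_) ℓ≡ k<ℓ))

  σ^-multiple : ∀ j q → σ^ (q ℕ.* ℓ j) j ≡ j
  σ^-multiple j zero    = refl
  σ^-multiple j (suc q) =
    trans (σ^-+ (ℓ j) (q ℕ.* ℓ j) j) (trans (cong (σ^ (ℓ j)) (σ^-multiple j q)) (σ^ℓ j))

  σ^-mod : ∀ j s → σ^ s j ≡ σ^ (s % ℓ j) j
  σ^-mod j s = begin
    σ^ s j                                   ≡⟨ cong (λ z → σ^ z j) (m≡m%n+[m/n]*n s (ℓ j)) ⟩
    σ^ (s % ℓ j ℕ.+ (s / ℓ j) ℕ.* ℓ j) j     ≡⟨ σ^-+ (s % ℓ j) _ j ⟩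
    σ^ (s % ℓ j) (σ^ ((s / ℓ j) ℕ.* ℓ j) j)  ≡⟨ cong (σ^ (s % ℓ j)) (σ^-multiple j (s / ℓ j)) ⟩
    σ^ (s % ℓ j) j                           ∎
    where open ≡-Reasoning

  σ^-gap : ∀ j {a b} → a < b → σ^ b j ≡ σ^ a j → σ^ (b ∸ a) j ≡ j
  σ^-gap j {a} {b} a<b e = σ^-injective a (begin
    σ^ a (σ^ (b ∸ a) j) ≡⟨ sym (σ^-+ a (b ∸ a) j) ⟩
    σ^ (a ℕ.+ (b ∸ a)) j ≡⟨ cong (λ z → σ^ z j) (ℕP.m+[n∸m]≡n (ℕP.<⇒≤ a<b)) ⟩
    σ^ b j               ≡⟨ e ⟩
    σ^ a j               ∎)
    where open ≡-Reasoning

  σ^-distinct : ∀ j {a b} → a < ℓ j → b < ℓ j → σ^ a j ≡ σ^ b j → a ≡ b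
  σ^-distinct j {a} {b} a< b< e with ℕP.<-cmp a b
  ... | tri≈ _ a≡b _ = a≡b
  ... | tri< a<b _ _ = ⊥-elim (ℓ-minimal j (b ∸ a) (ℕP.m<n⇒0<n∸m a<b) (ℕP.≤-<-trans (ℕP.m∸n≤m b a) b<)
                                (σ^-gap j a<b (sym e)))
  ... | tri> _ _ b<a = ⊥-elim (ℓ-minimal j (a ∸ b) (ℕP.m<n⇒0<n∸m b<a) (ℕP.≤-<-trans (ℕP.m∸n≤m a b) a<)
                                (σ^-gap j b<a e))

  same-orbit : ∀ {j j′} a b → σ^ a j ≡ σ^ b j′ → ∃ λ c → c < ℓ j × j′ ≡ σ^ c j
  same-orbit {j} {j′} a b e = (x ℕ.+ a) % ℓ j , m%n<n _ (ℓ j) , j′-on-orbit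
    where
    -- x + b is a multiple of ℓ j′, so σ^x undoes σ^b on j′
    x = b ℕ.* (ℓ j′ ∸ 1)
    x+b : x ℕ.+ b ≡ b ℕ.* ℓ j′
    x+b = trans (ℕP.+-comm x b) (trans (sym (ℕP.*-suc b (ℓ j′ ∸ 1))) (cong (b ℕ.*_) (ℕP.suc-pred (ℓ j′))))
    j′-on-orbit : j′ ≡ σ^ ((x ℕ.+ a) % ℓ j) j
    j′-on-orbit = begin
      j′                         ≡⟨ sym (σ^-multiple j′ b) ⟩
      σ^ (b ℕ.* ℓ j′) j′         ≡⟨ cong (λ z → σ^ z j′) (sym x+b) ⟩
      σ^ (x ℕ.+ b) j′            ≡⟨ σ^-+ x b j′ ⟩
      σ^ x (σ^ b j′)             ≡⟨ cong (σ^ x) (sym e) ⟩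
      σ^ x (σ^ a j)              ≡⟨ sym (σ^-+ x a j) ⟩
      σ^ (x ℕ.+ a) j             ≡⟨ σ^-mod j (x ℕ.+ a) ⟩
      σ^ ((x ℕ.+ a) % ℓ j) j     ∎
      where open ≡-Reasoning

  IsRep : Fin d → Set
  IsRep j = isCycleRep σ j ≡ true

  rep-minimal : ∀ {j} → IsRep j → ∀ k → k < d → toℕ j ≤ toℕ (σ^ k j)
  rep-minimal {j} rep k k<d = ℕP.≤ᵇ⇒≤ (toℕ j) (toℕ (σ^ k j))
    (subst T (sym (and-map-true⁻ (λ k → toℕ j ≤ᵇ toℕ (iter σ k j)) (upTo d) rep (∈-upTo⁺ k<d))) _)

  minimal-rep : ∀ {j} → (∀ k → k < d → toℕ j ≤ toℕ (σ^ k j)) → IsRep j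
  minimal-rep {j} min = and-map-true (λ k → toℕ j ≤ᵇ toℕ (iter σ k j)) (upTo d)
    (λ {k} k∈ → T⇒≡true (ℕP.≤⇒≤ᵇ (min k (∈-upTo⁻ k∈))))

  rep-unique : ∀ {j j′} → IsRep j → IsRep j′ → ∀ a b → σ^ a j ≡ σ^ b j′ → j ≡ j′
  rep-unique {j} {j′} rep rep′ a b e with same-orbit a b e | same-orbit b a (sym e)
  ... | c , c< , j′≡ | c′ , c′< , j≡ = FinP.toℕ-injective (ℕP.≤-antisym
        (subst (λ z → toℕ j ≤ toℕ z) (sym j′≡) (rep-minimal rep c (ℕP.<-≤-trans c< (ℓ≤d j))))
        (subst (λ z → toℕ j′ ≤ toℕ z) (sym j≡) (rep-minimal rep′ c′ (ℕP.<-≤-trans c′< (ℓ≤d j′)))))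

  orbit-injective : ∀ {j j′} → IsRep j → IsRep j′ → ∀ {a b} → a < ℓ j → b < ℓ j′ →
    σ^ a j ≡ σ^ b j′ → (j ≡ j′) × (a ≡ b)
  orbit-injective {j} rep rep′ {a} {b} a< b< e with rep-unique rep rep′ a b e
  ... | refl = refl , σ^-distinct j a< b< e

  -- ... and surjective: the least element of the orbit of j₀ represents it
  orbit-surjective : ∀ j₀ → ∃ λ j → IsRep j × ∃ λ q → q < ℓ j × σ^ q j ≡ j₀
  orbit-surjective j₀ with argmin (λ k → toℕ (σ^ k j₀)) d (ℕP.≤-<-trans z≤n (FinP.toℕ<n j₀))
  ... | k₀ , k₀<d , k₀-min with same-orbit {σ^ k₀ j₀} {j₀} 0 k₀ refl
  ...   | q , q< , j₀≡ = j , j-rep , q , q< , sym j₀≡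
    where
    j = σ^ k₀ j₀
    j-rep : IsRep j
    j-rep = minimal-rep λ k k<d → subst (λ z → toℕ j ≤ toℕ z)
      (sym (trans (sym (σ^-+ k k₀ j₀)) (σ^-mod j₀ (k ℕ.+ k₀))))
      (k₀-min _ (ℕP.<-≤-trans (m%n<n (k ℕ.+ k₀) (ℓ j₀)) (ℓ≤d j₀)))

unique-↭ : {A : Set} {xs ys : List A} → Unique xs → Unique ys →
  (∀ {z} → z ∈ xs → z ∈ ys) → (∀ {z} → z ∈ ys → z ∈ xs) → xs ↭ ys
unique-↭ xs! ys! xs⊆ys ys⊆xs = ∼bag⇒↭ (unique∧set⇒bag xs! ys! (mk⇔ xs⊆ys ys⊆xs))

AllPairs-from : {A : Set} {P : A → Set} {R S : A → A → Set} → (∀ {x y} → P x → P y → R x y → S x y) →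
  ∀ {xs} → All P xs → AllPairs R xs → AllPairs S xs
AllPairs-from h []          []          = []
AllPairs-from h (px ∷ pxs) (rx ∷ rxs) =
  All.zipWith (λ (py , r) → h px py r) (pxs , rx) ∷ AllPairs-from h pxs rxs

injective⇒surjective : ∀ {d} (h : Fin d → Fin d) → (∀ {a b} → h a ≡ h b → a ≡ b) → ∀ y → ∃ λ x → h x ≡ y
injective⇒surjective {suc d} h h-inj y with FinP.any? (λ x → h x FinP.≟ y)
... | yes hit  = hit
... | no  miss = ⊥-elim (ℕP.<-irrefl refl (FinP.injective⇒≤ {f = h′} h′-inj))
  where
  -- if y were missed, h would inject Fin (suc d) into Fin d
  h′ : Fin (suc d) → Fin d
  h′ x = punchOut {i = y} {j = h x} (λ e → miss (x , sym e))
  h′-inj : ∀ {a b} → h′ a ≡ h′ b → a ≡ b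
  h′-inj {a} {b} e = h-inj (FinP.punchOut-injective (λ e′ → miss (a , sym e′)) (λ e′ → miss (b , sym e′)) e)

Φ : {d : ℕ} → (ℕ → Perm d) → ℕ → Fin d → Fin d
Φ g zero    j = j
Φ g (suc t) j = lookup (g t) (Φ g t j)

Φ-+ : ∀ {d} (g : ℕ → Perm d) a b j → Φ g (a ℕ.+ b) j ≡ Φ (λ t → g (a ℕ.+ t)) b (Φ g a j)
Φ-+ g a zero    j = cong (λ z → Φ g z j) (ℕP.+-identityʳ a)
Φ-+ g a (suc b) j = trans (cong (λ z → Φ g z j) (ℕP.+-suc a b)) (cong (lookup (g (a ℕ.+ b))) (Φ-+ g a b j))

Φ-cong : ∀ {d} {g g′ : ℕ → Perm d} m → (∀ t → t < m → g t ≡ g′ t) → ∀ j → Φ g m j ≡ Φ g′ m j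
Φ-cong zero    g≗g′ j = refl
Φ-cong (suc m) g≗g′ j = cong₂ lookup (g≗g′ m (ℕP.n<1+n m)) (Φ-cong m (λ t t< → g≗g′ t (ℕP.m<n⇒m<1+n t<)) j)

Φ-injective : ∀ {d} (g : ℕ → Perm d) → (∀ t → Injective (g t)) → ∀ m {a b} → Φ g m a ≡ Φ g m b → a ≡ b
Φ-injective g g-inj zero    e = e
Φ-injective g g-inj (suc m) e = Φ-injective g g-inj m (g-inj m e)

product : ∀ {d k} → Vec (Perm d) k → Fin d → Fin d
product []ᵥ        j = j
product (σ₀ ∷ᵥ σs) j = product σs (lookup σ₀ j)

product-injective : ∀ {d k} (σs : Vec (Perm d) k) → (∀ i → Injective (lookup σs i)) →
  ∀ {a b} → product σs a ≡ product σs b → a ≡ b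
product-injective []ᵥ        _      e = e
product-injective (σ₀ ∷ᵥ σs) σs-inj e = σs-inj fzero (product-injective σs (λ i → σs-inj (fsuc i)) e)

-- σs as a sequence indexed by ℕ (padded with the identity)
at : ∀ {d k} → Vec (Perm d) k → ℕ → Perm d
at []ᵥ        t       = tabulate (λ j → j)
at (σ₀ ∷ᵥ σs) zero    = σ₀
at (σ₀ ∷ᵥ σs) (suc t) = at σs t

lookup-at : ∀ {d k} (σs : Vec (Perm d) k) (i : Fin k) → lookup σs i ≡ at σs (toℕ i)
lookup-at (σ₀ ∷ᵥ σs) fzero    = refl
lookup-at (σ₀ ∷ᵥ σs) (fsuc i) = lookup-at σs i

product-Φ : ∀ {d k} (σs : Vec (Perm d) k) j → product σs j ≡ Φ (at σs) k j
product-Φ []ᵥ                 j = refl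
product-Φ {k = suc k} (σ₀ ∷ᵥ σs) j = trans (product-Φ σs (lookup σ₀ j)) (sym (Φ-+ (at (σ₀ ∷ᵥ σs)) 1 k j))

iter-lookup : ∀ {d} (σ : Perm d) q j → iter σ q (lookup σ j) ≡ lookup σ (iter σ q j)
iter-lookup σ zero    j = refl
iter-lookup σ (suc q) j = cong (lookup σ) (iter-lookup σ q j)

toℕ-sucMod : ∀ {m} .{{_ : NonZero m}} (t : Fin m) → toℕ (sucMod t) ≡ suc (toℕ t) % m
toℕ-sucMod {suc m} t = FinP.toℕ-fromℕ< _

toℕ-mod : ∀ t n .{{_ : NonZero n}} → toℕ (t mod n) ≡ t % n
toℕ-mod t n = FinP.toℕ-fromℕ< _

suc-% : ∀ t n .{{_ : NonZero n}} → suc t % n ≡ suc (t % n) % n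
suc-% t n = trans (%-distribˡ-+ 1 t n)
                 (trans (cong (λ z → (1 % n ℕ.+ z) % n) (sym (m%n%n≡m%n t n))) (sym (%-distribˡ-+ 1 (t % n) n)))

-- Walking around the cover from (0 , j) for t steps
-- reaches (t mod n , Φ step t j); after n steps the second coordinate has been
-- moved by the product π = λ(0⁺) ⋯ λ((n-1)⁺).  Hence the walk from (0 , j)
-- closes up after exactly n·ℓ(j) steps, ℓ(j) the length of the π-cycle of j,
-- and the components of the cover are cycles C_{n·ℓ(c)}, one for each cycle c of π.
module Walk {n′ d : ℕ} (lab : Vec (Perm d) (suc n′)) (lab-inj : ∀ i → Injective (lookup lab i)) where

  n : ℕ
  n = suc n′

  step : ℕ → Perm d
  step t = lookup lab (t mod n)

  π : Perm d
  π = tabulate (product lab)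

  π-inj : Injective π
  π-inj {a} {b} e = product-injective lab lab-inj
    (trans (sym (VecP.lookup∘tabulate (product lab) a)) (trans e (VecP.lookup∘tabulate (product lab) b)))

  open Orbits π π-inj public

  mod-≡ : ∀ s t → s % n ≡ t % n → s mod n ≡ t mod n
  mod-≡ s t e = FinP.toℕ-injective (trans (toℕ-mod s n) (trans e (sym (toℕ-mod t n))))

  step-periodic : ∀ q t → step (q ℕ.* n ℕ.+ t) ≡ step t
  step-periodic q t = cong (lookup lab)
    (mod-≡ (q ℕ.* n ℕ.+ t) t (trans (cong (_% n) (ℕP.+-comm (q ℕ.* n) t)) ([m+kn]%n≡m%n t q n)))

  step-shift : ∀ t → step (n ℕ.+ t) ≡ step t
  step-shift t = trans (cong (λ m → step (m ℕ.+ t)) (sym (ℕP.*-identityˡ n))) (step-periodic 1 t)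

  Φ-round : ∀ j → Φ step n j ≡ lookup π j
  Φ-round j = begin
    Φ step n j          ≡⟨ Φ-cong n step≡at j ⟩
    Φ (at lab) n j      ≡⟨ sym (product-Φ lab j) ⟩
    product lab j       ≡⟨ sym (VecP.lookup∘tabulate (product lab) j) ⟩
    lookup π j          ∎
    where
    open ≡-Reasoning
    step≡at : ∀ t → t < n → step t ≡ at lab t
    step≡at t t<n = trans (lookup-at lab (t mod n)) (cong (at lab) (trans (toℕ-mod t n) (m<n⇒m%n≡m t<n)))

  Φ-rounds : ∀ q j → Φ step (q ℕ.* n) j ≡ σ^ q j
  Φ-rounds zero    j = refl
  Φ-rounds (suc q) j = begin
    Φ step (n ℕ.+ q ℕ.* n) j                       ≡⟨ Φ-+ step n (q ℕ.* n) j ⟩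
    Φ (λ t → step (n ℕ.+ t)) (q ℕ.* n) (Φ step n j) ≡⟨ Φ-cong (q ℕ.* n) (λ t _ → step-shift t) _ ⟩
    Φ step (q ℕ.* n) (Φ step n j)                  ≡⟨ cong (Φ step (q ℕ.* n)) (Φ-round j) ⟩
    Φ step (q ℕ.* n) (lookup π j)                  ≡⟨ Φ-rounds q (lookup π j) ⟩
    σ^ q (lookup π j)                              ≡⟨ iter-lookup π q j ⟩
    σ^ (suc q) j                                   ∎
    where open ≡-Reasoning

  Φ-split : ∀ q r j → Φ step (q ℕ.* n ℕ.+ r) j ≡ Φ step r (σ^ q j)
  Φ-split q r j = trans (Φ-+ step (q ℕ.* n) r j)
                        (trans (Φ-cong r (λ t _ → step-periodic q t) _) (cong (Φ step r) (Φ-rounds q j)))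

  pos : Fin d → ℕ → Fin n × Fin d
  pos j t = (t mod n , Φ step t j)

  M : Fin d → ℕ
  M j = n ℕ.* ℓ j

  instance
    M-nonZero : ∀ {j} → NonZero (M j)
    M-nonZero {j} = ℕP.m*n≢0 n (ℓ j)

  pos-periodic : ∀ j s → pos j (s % M j) ≡ pos j s
  pos-periodic j s = cong₂ _,_ (mod-≡ r s same-phase) same-point
    where
    r = s % M j
    K = (s / M j) ℕ.* ℓ j
    s≡ : s ≡ K ℕ.* n ℕ.+ r
    s≡ = trans (m≡m%n+[m/n]*n s (M j)) (regroup r (s / M j) (ℓ j) n)
      where
      regroup : ∀ r q c n → r ℕ.+ q ℕ.* (n ℕ.* c) ≡ (q ℕ.* c) ℕ.* n ℕ.+ r
      regroup = solve-∀
    same-phase : r % n ≡ s % n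
    same-phase = sym (trans (cong (_% n) (trans s≡ (ℕP.+-comm (K ℕ.* n) r))) ([m+kn]%n≡m%n r K n))
    same-point : Φ step r j ≡ Φ step s j
    same-point = sym (trans (cong (λ z → Φ step z j) s≡)
                            (trans (Φ-split K r j) (cong (Φ step r) (σ^-multiple j (s / M j)))))

  coverEdge : Fin n × Fin d → (Fin n × Fin d) × (Fin n × Fin d)
  coverEdge (i , x) = ((i , x) , (sucMod i , lookup (lookup lab i) x))

  walk : (j : Fin d) → Fin (M j) → Fin n × Fin d
  walk j t = pos j (toℕ t)

  walk-edge : ∀ j (t : Fin (M j)) → (walk j t , walk j (sucMod t)) ≡ coverEdge (walk j t)
  walk-edge j t = cong (walk j t ,_) (begin
    pos j (toℕ (sucMod t))          ≡⟨ cong (pos j) (toℕ-sucMod t) ⟩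
    pos j (suc (toℕ t) % M j)       ≡⟨ pos-periodic j (suc (toℕ t)) ⟩
    pos j (suc (toℕ t))             ≡⟨ cong (_, Φ step (suc (toℕ t)) j)
                                            (mod-≡ (suc (toℕ t)) (suc (toℕ (toℕ t mod n)))
                                                   (trans (suc-% (toℕ t) n) (cong (λ z → suc z % n) (sym (toℕ-mod (toℕ t) n))))) ⟩
    (sucMod (toℕ t mod n) , lookup (lookup lab (toℕ t mod n)) (Φ step (toℕ t) j)) ∎)
    where open ≡-Reasoning

  euclid : ∀ t → t ≡ (t / n) ℕ.* n ℕ.+ t % n
  euclid t = trans (m≡m%n+[m/n]*n t n) (ℕP.+-comm (t % n) _)

  pos-phase : ∀ {j j′ t t′} → pos j t ≡ pos j′ t′ → t % n ≡ t′ % n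
  pos-phase {t = t} {t′} e = trans (sym (toℕ-mod t n)) (trans (cong (λ v → toℕ (proj₁ v)) e) (toℕ-mod t′ n))

  Φ-euclid : ∀ j t → Φ step t j ≡ Φ step (t % n) (σ^ (t / n) j)
  Φ-euclid j t = trans (cong (λ z → Φ step z j) (euclid t)) (Φ-split (t / n) (t % n) j)

  rounds< : ∀ j t → t < M j → t / n < ℓ j
  rounds< j t t< = m<n*o⇒m/o<n (subst (t <_) (ℕP.*-comm n (ℓ j)) t<)

  pos-injective : ∀ {j j′} → IsRep j → IsRep j′ → ∀ {t t′} → t < M j → t′ < M j′ →
    pos j t ≡ pos j′ t′ → (j ≡ j′) × (t ≡ t′)
  pos-injective {j} {j′} rep rep′ {t} {t′} t< t′< e
    with orbit-injective rep rep′ (rounds< j t t<) (rounds< j′ t′ t′<) same-round-start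
    where
    same-round-start : σ^ (t / n) j ≡ σ^ (t′ / n) j′
    same-round-start = Φ-injective step (λ t → lab-inj (t mod n)) (t % n) (begin
      Φ step (t % n) (σ^ (t / n) j)     ≡⟨ sym (Φ-euclid j t) ⟩
      Φ step t j                        ≡⟨ cong proj₂ e ⟩
      Φ step t′ j′                      ≡⟨ Φ-euclid j′ t′ ⟩
      Φ step (t′ % n) (σ^ (t′ / n) j′)  ≡⟨ cong (λ z → Φ step z (σ^ (t′ / n) j′)) (sym (pos-phase {j} {j′} {t} {t′} e)) ⟩
      Φ step (t % n) (σ^ (t′ / n) j′)   ∎)
      where open ≡-Reasoning
  ... | refl , same-rounds =
    refl , trans (euclid t) (trans (cong₂ (λ a b → a ℕ.* n ℕ.+ b) same-rounds (pos-phase {j} {j′} {t} {t′} e)) (sym (euclid t′)))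

  pos-surjective : ∀ (v : Fin n × Fin d) → ∃ λ j → IsRep j × ∃ λ t → t < M j × pos j t ≡ v
  pos-surjective (i , x)
    with injective⇒surjective (Φ step (toℕ i)) (Φ-injective step (λ t → lab-inj (t mod n)) (toℕ i)) x
  ... | x₀ , x₀↦x with orbit-surjective x₀
  ...   | j , rep , q , q< , σ^q≡x₀ = j , rep , t , t< , cong₂ _,_ phase point
    where
    t = q ℕ.* n ℕ.+ toℕ i
    t< : t < M j
    t< = ℕP.<-≤-trans (ℕP.+-monoʳ-< (q ℕ.* n) (FinP.toℕ<n i))
           (subst (_≤ M j) (ℕP.+-comm n (q ℕ.* n)) (subst (suc q ℕ.* n ≤_) (ℕP.*-comm (ℓ j) n) (ℕP.*-monoˡ-≤ n q<)))
    phase : t mod n ≡ i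
    phase = FinP.toℕ-injective (trans (toℕ-mod t n) (trans (cong (_% n) (ℕP.+-comm (q ℕ.* n) (toℕ i)))
              (trans ([m+kn]%n≡m%n (toℕ i) q n) (m<n⇒m%n≡m (FinP.toℕ<n i)))))
    point : Φ step t j ≡ x
    point = trans (Φ-split q (toℕ i) j) (trans (cong (Φ step (toℕ i)) σ^q≡x₀) x₀↦x)

length-cartesianProduct : {A B : Set} (xs : List A) (ys : List B) →
  length (cartesianProduct xs ys) ≡ length xs ℕ.* length ys
length-cartesianProduct []       ys = refl
length-cartesianProduct (x ∷ xs) ys =
  trans (ListP.length-++ (map (x ,_) ys)) (cong₂ ℕ._+_ (ListP.length-map (x ,_) ys) (length-cartesianProduct xs ys))

length-concatMap : {A B : Set} (f : A → List B) (xs : List A) → length (concatMap f xs) ≡ sum (map (length ∘ f) xs)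
length-concatMap f []       = refl
length-concatMap f (x ∷ xs) = trans (ListP.length-++ (f x)) (cong (length (f x) ℕ.+_) (length-concatMap f xs))

cycleProduct : ℕ → ∀ {d} → Perm d → Poly
cycleProduct n σ = prodP (map (λ l → cycPoly (n ℕ.* l)) (cycleType σ))

-- The vertex list of the cover is a
-- rearrangement of the concatenated closed walks from the cycle
-- representatives, and its edge list a rearrangement of their edge lists;
-- the walks are vertex-disjoint relabelled copies of the cycles C_{M j}.
module CoverDecomposition {n′ d : ℕ} (lab : Vec (Perm d) (suc n′))
                          (lab-inj : ∀ i → Injective (lookup lab i)) where
  open Walk lab lab-inj

  walk-injective : ∀ {j} → IsRep j → ∀ {a b} → walk j a ≡ walk j b → a ≡ b
  walk-injective rep {a} {b} e = FinP.toℕ-injective (proj₂ (pos-injective rep rep (FinP.toℕ<n a) (FinP.toℕ<n b) e))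

  reps : List (Fin d)
  reps = filterᵇ (isCycleRep π) (allFin d)

  reps-unique : Unique reps
  reps-unique = UniqueP.filter⁺ (T? ∘ isCycleRep π) (UniqueP.allFin⁺ d)

  reps-rep : All IsRep reps
  reps-rep = All.tabulate (λ j∈ → T⇒≡true (proj₂ (∈-filter⁻ (T? ∘ isCycleRep π) {xs = allFin d} j∈)))

  rep∈reps : ∀ {j} → IsRep j → j ∈ reps
  rep∈reps {j} rep = ∈-filter⁺ (T? ∘ isCycleRep π) (∈-allFin j) (subst T (sym rep) _)

  walkVertices : Fin d → List (Fin n × Fin d)
  walkVertices j = map (walk j) (allFin (M j))

  walkEdges : Fin d → List ((Fin n × Fin d) × (Fin n × Fin d))
  walkEdges j = map (λ t → (walk j t , walk j (sucMod t))) (allFin (M j))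

  allVertices : List (Fin n × Fin d)
  allVertices = cartesianProduct (allFin n) (allFin d)

  walkVertices-unique : Unique (concatMap walkVertices reps)
  walkVertices-unique =
    UniqueP.concat⁺ (AllP.map⁺ (All.map (λ rep → UniqueP.map⁺ (walk-injective rep) (UniqueP.allFin⁺ _)) reps-rep))
                    (AllPairsP.map⁺ (AllPairs-from disjoint-walks reps-rep reps-unique))
    where
    disjoint-walks : ∀ {j j′} → IsRep j → IsRep j′ → j ≢ j′ → Disjoint (walkVertices j) (walkVertices j′)
    disjoint-walks {j} {j′} rep rep′ j≢j′ (v∈ , v∈′) with ∈-map⁻ (walk j) v∈ | ∈-map⁻ (walk j′) v∈′
    ... | a , _ , refl | b , _ , e = j≢j′ (proj₁ (pos-injective rep rep′ (FinP.toℕ<n a) (FinP.toℕ<n b) e))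

  vertices↭walks : allVertices ↭ concatMap walkVertices reps
  vertices↭walks = unique-↭ (UniqueP.cartesianProduct⁺ (UniqueP.allFin⁺ n) (UniqueP.allFin⁺ d))
                            walkVertices-unique
                            (λ {v} _ → on-walk v (pos-surjective v))
                            (λ {(i , x)} _ → ∈-cartesianProduct⁺ (∈-allFin i) (∈-allFin x))
    where
    on-walk : ∀ v → (∃ λ j → IsRep j × ∃ λ t → t ℕ.< M j × pos j t ≡ v) → v ∈ concatMap walkVertices reps
    on-walk v (j , rep , t , t< , e) =
      ∈-concat⁺′ (subst (_∈ walkVertices j) (trans (cong (pos j) (FinP.toℕ-fromℕ< t<)) e)
                        (∈-map⁺ (walk j) (∈-allFin (fromℕ< t<))))
                 (∈-map⁺ walkVertices (rep∈reps rep))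

  coverEdges↭walkEdges : coverEdges lab ↭ concatMap walkEdges reps
  coverEdges↭walkEdges = subst₂ _↭_ (sym (edges-by-vertex (allFin n))) edges-of-walks (↭P.map⁺ coverEdge vertices↭walks)
    where
    edges-by-vertex : ∀ (is : List (Fin n)) →
      concatMap (λ i → map (λ x → coverEdge (i , x)) (allFin d)) is ≡ map coverEdge (cartesianProduct is (allFin d))
    edges-by-vertex []       = refl
    edges-by-vertex (i ∷ is) = trans (cong₂ _++_ (ListP.map-∘ (allFin d)) (edges-by-vertex is))
                                     (sym (ListP.map-++ coverEdge (map (i ,_) (allFin d)) _))
    edges-of-walks : map coverEdge (concatMap walkVertices reps) ≡ concatMap walkEdges reps
    edges-of-walks = trans (ListP.map-concatMap coverEdge walkVertices reps) (ListP.concatMap-cong (λ j →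
      trans (sym (ListP.map-∘ (allFin (M j)))) (ListP.map-cong (λ t → sym (walk-edge j t)) (allFin (M j)))) reps)

  _≟v_ : DecidableEquality (Fin n × Fin d)
  _≟v_ = ProdP.≡-dec FinP._≟_ FinP._≟_

  open Matchings _≟v_

  walks-cross : AllPairs (λ j j′ → Cross (walkEdges j) (walkEdges j′)) reps
  walks-cross = AllPairs-from cross reps-rep reps-unique
    where
    cross : ∀ {j j′} → IsRep j → IsRep j′ → j ≢ j′ → Cross (walkEdges j) (walkEdges j′)
    cross {j} {j′} rep rep′ j≢j′ e₁∈ e₂∈ with ∈-map⁻ _ e₁∈ | ∈-map⁻ _ e₂∈
    ... | a , _ , refl | b , _ , refl =
      disj-intro (apart a b) (apart a (sucMod b)) (apart (sucMod a) b) (apart (sucMod a) (sucMod b))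
      where
      apart : ∀ x y → walk j x ≢ walk j′ y
      apart x y e = j≢j′ (proj₁ (pos-injective rep rep′ (FinP.toℕ<n x) (FinP.toℕ<n y) e))

  module Component {j : Fin d} (rep : IsRep j) where
    open Relabel FinP._≟_ _≟v_ (walk j) (walk-injective rep)

    walkEdges≡ : walkEdges j ≡ map gEdge (cycleEdges (M j))
    walkEdges≡ = ListP.map-∘ (allFin (M j))

    bounded : Bounded (M j) (walkEdges j)
    bounded = subst (Bounded (M j)) (sym walkEdges≡) (Bounded-relabel {N = M j} {E = cycleEdges (M j)} (Fin-Bounded (M j) (cycleEdges (M j))))

    coeffSum≡cycPoly : ∀ k → coeffSum (M j) (walkEdges j) k ≡ cycPoly (n ℕ.* ℓ j) k
    coeffSum≡cycPoly k = begin
      coeffSum (M j) (walkEdges j) k                        ≡⟨ cong (λ E → coeffSum (M j) E k) walkEdges≡ ⟩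
      coeffSum (M j) (map gEdge (cycleEdges (M j))) k       ≡⟨ coeffSum-relabel (M j) (cycleEdges (M j)) k ⟩
      Matchings.coeffSum FinP._≟_ (M j) (cycleEdges (M j)) k ≡⟨ sym (Matchings.matchingPoly-coeff FinP._≟_ (M j) (cycleEdges (M j)) k) ⟩
      cycPoly (n ℕ.* ℓ j) k                                 ∎
      where open ≡-Reasoning

  vertex-count : n ℕ.* d ≡ sum (map M reps)
  vertex-count = begin
    n ℕ.* d                                         ≡⟨ cong₂ ℕ._*_ (sym (ListP.length-tabulate {n = n} (λ x → x)))
                                                                   (sym (ListP.length-tabulate {n = d} (λ x → x))) ⟩
    length (allFin n) ℕ.* length (allFin d)         ≡⟨ sym (length-cartesianProduct (allFin n) (allFin d)) ⟩
    length allVertices                              ≡⟨ ↭P.↭-length vertices↭walks ⟩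
    length (concatMap walkVertices reps)            ≡⟨ length-concatMap walkVertices reps ⟩
    sum (map (length ∘ walkVertices) reps)          ≡⟨ cong sum (ListP.map-cong walk-length reps) ⟩
    sum (map M reps)                                ∎
    where
    open ≡-Reasoning
    walk-length : ∀ j → length (walkVertices j) ≡ M j
    walk-length j = trans (ListP.length-map (walk j) (allFin (M j))) (ListP.length-tabulate {n = M j} (λ z → z))

  cover-matchingPoly : ∀ k → coverPoly lab k ≡ cycleProduct n π k
  cover-matchingPoly k = begin
    coverPoly lab k                                               ≡⟨ matchingPoly-coeff (n ℕ.* d) (coverEdges lab) k ⟩
    coeffSum (n ℕ.* d) (coverEdges lab) k                         ≡⟨ coeffSum-↭ (n ℕ.* d) coverEdges↭walkEdges k ⟩
    coeffSum (n ℕ.* d) (concatMap walkEdges reps) k               ≡⟨ cong (λ N → coeffSum N (concatMap walkEdges reps) k) vertex-count ⟩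
    coeffSum (sum (map M reps)) (concatMap walkEdges reps) k      ≡⟨ coeffSum-concat _≟v_ M walkEdges reps walks-cross
                                                                       (All.map Component.bounded reps-rep) k ⟩
    prodP (map (λ j → coeffSum (M j) (walkEdges j)) reps) k       ≡⟨ prodP-cong _ _ reps (λ j∈ → Component.coeffSum≡cycPoly (All.lookup reps-rep j∈)) k ⟩
    prodP (map (λ j → cycPoly (n ℕ.* ℓ j)) reps) k               ≡⟨ cong (λ ps → prodP ps k) (ListP.map-∘ reps) ⟩
    cycleProduct n π k                                            ∎
    where open ≡-Reasoning

or-map-true : {A : Set} (f : A → Bool) {x : A} (xs : List A) → x ∈ xs → f x ≡ true → or (map f xs) ≡ true
or-map-true f (y ∷ xs) (here refl) fx rewrite fx = refl
or-map-true f (y ∷ xs) (there x∈)  fx with f y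
... | true  = refl
... | false = or-map-true f xs x∈ fx

isBijection⇒Injective : ∀ {d} (σ : Perm d) → isBijection σ ≡ true → Injective σ
isBijection⇒Injective {d} σ bij {a} {b} σa≡σb =
  ≡F⇒≡ (subst (λ z → not z ∨ (a ≡F b) ≡ true) σa≡Fσb entry)
  where
  row = and-map-true⁻ _ (allFin d) (proj₁ (∧-true⁻ bij)) (∈-allFin a)
  entry = and-map-true⁻ _ (allFin d) row (∈-allFin b)
  σa≡Fσb : (lookup σ a ≡F lookup σ b) ≡ true
  σa≡Fσb = subst (λ z → (lookup σ a ≡F z) ≡ true) σa≡σb (≡F-refl (lookup σ a))

Injective⇒isBijection : ∀ {d} (σ : Perm d) → Injective σ → isBijection σ ≡ true
Injective⇒isBijection {d} σ σ-inj = cong₂ _∧_ injective surjective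
  where
  entry : ∀ i j → (not (lookup σ i ≡F lookup σ j) ∨ (i ≡F j)) ≡ true
  entry i j with lookup σ i ≡F lookup σ j in eq
  ... | true  = subst (λ z → (i ≡F z) ≡ true) (σ-inj (≡F⇒≡ eq)) (≡F-refl i)
  ... | false = refl
  injective = and-map-true _ (allFin d) (λ {i} _ → and-map-true _ (allFin d) (λ {j} _ → entry i j))
  surjective = and-map-true _ (allFin d) (λ {k} _ →
    let (i , σi≡k) = injective⇒surjective (lookup σ) σ-inj k in
    or-map-true (λ i → lookup σ i ≡F k) (allFin d) (∈-allFin i) (subst (λ z → (z ≡F k) ≡ true) (sym σi≡k) (≡F-refl k)))

tuples-unique : {A : Set} {xs : List A} (k : ℕ) → Unique xs → Unique (tuples xs k)
tuples-unique zero    xs! = AllPairs._∷_ [] AllPairs.[]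
tuples-unique {xs = xs} (suc k) xs! =
  UniqueP.concat⁺ (AllP.map⁺ (All.tabulate (λ _ → UniqueP.map⁺ VecP.∷-injectiveʳ (tuples-unique k xs!))))
                  (AllPairsP.map⁺ (AllPairs.map different-heads xs!))
  where
  different-heads : ∀ {x y} → x ≢ y → Disjoint (map (x ∷ᵥ_) (tuples xs k)) (map (y ∷ᵥ_) (tuples xs k))
  different-heads {x} {y} x≢y (v∈ , v∈′) with ∈-map⁻ (x ∷ᵥ_) v∈ | ∈-map⁻ (y ∷ᵥ_) v∈′
  ... | _ , _ , refl | _ , _ , e = x≢y (VecP.∷-injectiveˡ e)

tuples-complete : ∀ {d} k (v : Vec (Fin d) k) → v ∈ tuples (allFin d) k
tuples-complete zero    []ᵥ       = here refl
tuples-complete {d} (suc k) (x ∷ᵥ v) =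
  ∈-concat⁺′ (∈-map⁺ (x ∷ᵥ_) (tuples-complete k v)) (∈-map⁺ (λ x → map (x ∷ᵥ_) (tuples (allFin d) k)) (∈-allFin x))

tuples-entries : {A : Set} (xs : List A) (k : ℕ) {v : Vec A k} → v ∈ tuples xs k → ∀ i → lookup v i ∈ xs
tuples-entries xs (suc k) v∈ with ∈-concat⁻′ (map (λ x → map (x ∷ᵥ_) (tuples xs k)) xs) v∈
... | _ , v∈′ , block∈ with ∈-map⁻ (λ x → map (x ∷ᵥ_) (tuples xs k)) block∈
...   | x , x∈ , refl with ∈-map⁻ (x ∷ᵥ_) v∈′
...     | r , r∈ , refl = λ { fzero → x∈ ; (fsuc i) → tuples-entries xs k r∈ i }

sum-const : {A : Set} (c : ℕ) (ys : List A) → sum (map (λ _ → c) ys) ≡ length ys ℕ.* c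
sum-const c []       = refl
sum-const c (y ∷ ys) = cong (c ℕ.+_) (sum-const c ys)

length-tuples : {A : Set} (xs : List A) (k : ℕ) → length (tuples xs k) ≡ length xs ^ k
length-tuples xs zero    = refl
length-tuples xs (suc k) = begin
  length (concatMap (λ x → map (x ∷ᵥ_) (tuples xs k)) xs)     ≡⟨ length-concatMap _ xs ⟩
  sum (map (λ x → length (map (x ∷ᵥ_) (tuples xs k))) xs)    ≡⟨ cong sum (ListP.map-cong (λ x → trans (ListP.length-map (x ∷ᵥ_) (tuples xs k)) (length-tuples xs k)) xs) ⟩
  sum (map (λ _ → length xs ^ k) xs)                         ≡⟨ sum-const (length xs ^ k) xs ⟩
  length xs ℕ.* length xs ^ k                                 ∎
  where open ≡-Reasoning

-- Counting S_d.  A permutation is a tuple without repeated entries (distinct),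
-- and the distinct k-tuples over a list with m elements number m (m-1) ⋯ (m-k+1).
occurs : ∀ {d k} → Fin d → Vec (Fin d) k → Bool
occurs x []ᵥ       = false
occurs x (y ∷ᵥ v) = (x ≡F y) ∨ occurs x v

distinct : ∀ {d k} → Vec (Fin d) k → Bool
distinct []ᵥ       = true
distinct (x ∷ᵥ v) = not (occurs x v) ∧ distinct v

occurs-intro : ∀ {d k} {x : Fin d} (v : Vec (Fin d) k) i → lookup v i ≡ x → occurs x v ≡ true
occurs-intro (y ∷ᵥ v) fzero refl rewrite ≡F-refl y = refl
occurs-intro {x = x} (y ∷ᵥ v) (fsuc i) vi≡x with x ≡F y
... | true  = refl
... | false = occurs-intro v i vi≡x

occurs-elim : ∀ {d k} {x : Fin d} (v : Vec (Fin d) k) → occurs x v ≡ true → ∃ λ i → lookup v i ≡ x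
occurs-elim {x = x} (y ∷ᵥ v) h with x ≡F y in x≡y
... | true  = fzero , sym (≡F⇒≡ x≡y)
... | false with occurs-elim v h
...   | i , vi≡x = fsuc i , vi≡x

not-and-itself : ∀ {c} {A : Set} → not c ≡ true → c ≡ true → A
not-and-itself {true} () _

distinct⇒Injective : ∀ {d k} (v : Vec (Fin d) k) → distinct v ≡ true → ∀ {a b} → lookup v a ≡ lookup v b → a ≡ b
distinct⇒Injective (x ∷ᵥ v) h {fzero}  {fzero}  e = refl
distinct⇒Injective (x ∷ᵥ v) h {fzero}  {fsuc b} e = not-and-itself (proj₁ (∧-true⁻ h)) (occurs-intro v b (sym e))
distinct⇒Injective (x ∷ᵥ v) h {fsuc a} {fzero}  e = not-and-itself (proj₁ (∧-true⁻ h)) (occurs-intro v a e)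
distinct⇒Injective (x ∷ᵥ v) h {fsuc a} {fsuc b} e = cong fsuc (distinct⇒Injective v (proj₂ (∧-true⁻ h)) e)

Injective⇒distinct : ∀ {d k} (v : Vec (Fin d) k) → (∀ {a b} → lookup v a ≡ lookup v b → a ≡ b) → distinct v ≡ true
Injective⇒distinct []ᵥ       inj = refl
Injective⇒distinct (x ∷ᵥ v) inj = cong₂ _∧_ head-fresh (Injective⇒distinct v (λ e → FinP.suc-injective (inj e)))
  where
  head-fresh : not (occurs x v) ≡ true
  head-fresh with occurs x v in occ
  ... | false = refl
  ... | true with occurs-elim v occ
  ...   | i , vi≡x with inj {fzero} {fsuc i} (sym vi≡x)
  ...     | ()

isBijection≡distinct : ∀ {d} (σ : Perm d) → isBijection σ ≡ distinct σ
isBijection≡distinct σ with isBijection σ in bij | distinct σ in dist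
... | true  | true  = refl
... | false | false = refl
... | true  | false = trans (sym (Injective⇒distinct σ (isBijection⇒Injective σ bij))) dist
... | false | true  = trans (sym bij) (Injective⇒isBijection σ (distinct⇒Injective σ dist))

module _ {A : Set} where

  filterᵇ-∷ : (p : A → Bool) (x : A) (xs : List A) →
    filterᵇ p (x ∷ xs) ≡ (if p x then x ∷ filterᵇ p xs else filterᵇ p xs)
  filterᵇ-∷ p x xs with p x
  ... | true  = refl
  ... | false = refl

  filterᵇ-cong : {p q : A → Bool} → (∀ x → p x ≡ q x) → (xs : List A) → filterᵇ p xs ≡ filterᵇ q xs
  filterᵇ-cong p≗q []       = refl
  filterᵇ-cong {p} {q} p≗q (x ∷ xs)
    rewrite filterᵇ-∷ p x xs | filterᵇ-∷ q x xs | p≗q x | filterᵇ-cong p≗q xs = refl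

  filterᵇ-none : (xs : List A) → filterᵇ (λ _ → false) xs ≡ []
  filterᵇ-none []       = refl
  filterᵇ-none (x ∷ xs) = filterᵇ-none xs

  filterᵇ-all : (p : A → Bool) (xs : List A) → (∀ {x} → x ∈ xs → p x ≡ true) → filterᵇ p xs ≡ xs
  filterᵇ-all p []       all = refl
  filterᵇ-all p (x ∷ xs) all rewrite filterᵇ-∷ p x xs | all (here refl) = cong (x ∷_) (filterᵇ-all p xs (all ∘ there))

  filterᵇ-∧ : (p q : A → Bool) (xs : List A) → filterᵇ (λ v → p v ∧ q v) xs ≡ filterᵇ q (filterᵇ p xs)
  filterᵇ-∧ p q []       = refl
  filterᵇ-∧ p q (x ∷ xs) rewrite filterᵇ-∷ (λ v → p v ∧ q v) x xs | filterᵇ-∷ p x xs with p x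
  ... | false = filterᵇ-∧ p q xs
  ... | true rewrite filterᵇ-∷ q x (filterᵇ p xs) with q x
  ...   | true  = cong (x ∷_) (filterᵇ-∧ p q xs)
  ...   | false = filterᵇ-∧ p q xs

module _ {A B : Set} where

  filterᵇ-concatMap : (p : B → Bool) (h : A → List B) (xs : List A) →
    filterᵇ p (concatMap h xs) ≡ concatMap (filterᵇ p ∘ h) xs
  filterᵇ-concatMap p h []       = refl
  filterᵇ-concatMap p h (x ∷ xs) =
    trans (ListP.filter-++ _ (h x) (concatMap h xs)) (cong (filterᵇ p (h x) ++_) (filterᵇ-concatMap p h xs))

  concatMap-filterᵇ : (h : A → List B) (p : A → Bool) (xs : List A) →
    concatMap h (filterᵇ p xs) ≡ concatMap (λ y → if p y then h y else []) xs
  concatMap-filterᵇ h p []       = refl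
  concatMap-filterᵇ h p (x ∷ xs) rewrite filterᵇ-∷ p x xs with p x
  ... | true  = cong (h x ++_) (concatMap-filterᵇ h p xs)
  ... | false = concatMap-filterᵇ h p xs

filterᵇ-map-∷ : ∀ {A : Set} {k} (p : Vec A (suc k) → Bool) (x : A) (vs : List (Vec A k)) →
  filterᵇ p (map (x ∷ᵥ_) vs) ≡ map (x ∷ᵥ_) (filterᵇ (p ∘ (x ∷ᵥ_)) vs)
filterᵇ-map-∷ p x []       = refl
filterᵇ-map-∷ p x (v ∷ vs)
  rewrite filterᵇ-∷ p (x ∷ᵥ v) (map (x ∷ᵥ_) vs) | filterᵇ-∷ (p ∘ (x ∷ᵥ_)) v vs with p (x ∷ᵥ v)
... | true  = cong ((x ∷ᵥ v) ∷_) (filterᵇ-map-∷ p x vs)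
... | false = filterᵇ-map-∷ p x vs

remove : ∀ {d} → Fin d → List (Fin d) → List (Fin d)
remove x = filterᵇ (λ y → not (x ≡F y))

remove-length : ∀ {d} {x : Fin d} (xs : List (Fin d)) → Unique xs → x ∈ xs → length (remove x xs) ≡ length xs ∸ 1
remove-length {x = x} (y ∷ ys) (y∉ys ∷ _) (here refl) rewrite ≡F-refl x =
  cong length (filterᵇ-all _ ys (λ z∈ → ≢⇒not≡F (All.lookup y∉ys z∈)))
  where
  ≢⇒not≡F : ∀ {z} → x ≢ z → not (x ≡F z) ≡ true
  ≢⇒not≡F {z} x≢z with x ≡F z in x≡z
  ... | true  = ⊥-elim (x≢z (≡F⇒≡ x≡z))
  ... | false = refl
remove-length {x = x} (y ∷ ys@(_ ∷ _)) (y∉ys ∷ ys!) (there x∈) with x ≡F y in x≡y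
... | true  = ⊥-elim (All.lookup y∉ys x∈ (sym (≡F⇒≡ x≡y)))
... | false = cong suc (remove-length ys ys! x∈)

tuples-avoiding : ∀ {d} (x : Fin d) (xs : List (Fin d)) k →
  filterᵇ (λ v → not (occurs x v)) (tuples xs k) ≡ tuples (remove x xs) k
tuples-avoiding x xs zero    = refl
tuples-avoiding x xs (suc k) = begin
  filterᵇ avoids (concatMap (λ y → map (y ∷ᵥ_) (tuples xs k)) xs)                     ≡⟨ filterᵇ-concatMap avoids _ xs ⟩
  concatMap (λ y → filterᵇ avoids (map (y ∷ᵥ_) (tuples xs k))) xs                      ≡⟨ ListP.concatMap-cong by-head xs ⟩
  concatMap (λ y → if not (x ≡F y) then map (y ∷ᵥ_) (tuples (remove x xs) k) else []) xs ≡⟨ sym (concatMap-filterᵇ _ _ xs) ⟩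
  tuples (remove x xs) (suc k)                                                         ∎
  where
  open ≡-Reasoning
  avoids = λ (v : Vec (Fin _) (suc k)) → not (occurs x v)
  by-head : ∀ y → filterᵇ avoids (map (y ∷ᵥ_) (tuples xs k)) ≡
                  (if not (x ≡F y) then map (y ∷ᵥ_) (tuples (remove x xs) k) else [])
  by-head y rewrite filterᵇ-map-∷ avoids y (tuples xs k) with x ≡F y
  ... | true  = cong (map (y ∷ᵥ_)) (filterᵇ-none (tuples xs k))
  ... | false = cong (map (y ∷ᵥ_)) (tuples-avoiding x xs k)

falling : ℕ → ℕ → ℕ
falling m zero    = 1
falling m (suc k) = m ℕ.* falling (m ∸ 1) k

falling-! : ∀ m → falling m m ≡ m !
falling-! zero    = refl
falling-! (suc m) = cong (suc m ℕ.*_) (falling-! m)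

count-distinct : ∀ {d} k (xs : List (Fin d)) → Unique xs → length (filterᵇ distinct (tuples xs k)) ≡ falling (length xs) k
count-distinct zero    xs xs! = refl
count-distinct (suc k) xs xs! = begin
  length (filterᵇ distinct (concatMap with-head xs))           ≡⟨ cong length (filterᵇ-concatMap distinct with-head xs) ⟩
  length (concatMap (filterᵇ distinct ∘ with-head) xs)         ≡⟨ length-concatMap (filterᵇ distinct ∘ with-head) xs ⟩
  sum (map (length ∘ filterᵇ distinct ∘ with-head) xs)         ≡⟨ cong sum (map-congIn xs per-head) ⟩
  sum (map (λ _ → falling (length xs ∸ 1) k) xs)               ≡⟨ sum-const _ xs ⟩
  length xs ℕ.* falling (length xs ∸ 1) k                      ∎
  where
  open ≡-Reasoning
  with-head = λ y → map (y ∷ᵥ_) (tuples xs k)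
  map-congIn : ∀ {f g : Fin _ → ℕ} (ys : List (Fin _)) → (∀ {y} → y ∈ ys → f y ≡ g y) → map f ys ≡ map g ys
  map-congIn []       f≗g = refl
  map-congIn (y ∷ ys) f≗g = cong₂ _∷_ (f≗g (here refl)) (map-congIn ys (f≗g ∘ there))
  per-head : ∀ {y} → y ∈ xs → length (filterᵇ distinct (with-head y)) ≡ falling (length xs ∸ 1) k
  per-head {y} y∈ = begin
    length (filterᵇ distinct (map (y ∷ᵥ_) (tuples xs k)))               ≡⟨ cong length (filterᵇ-map-∷ distinct y (tuples xs k)) ⟩
    length (map (y ∷ᵥ_) (filterᵇ (λ v → not (occurs y v) ∧ distinct v) (tuples xs k)))
                                                                       ≡⟨ ListP.length-map (y ∷ᵥ_) (filterᵇ (λ v → not (occurs y v) ∧ distinct v) (tuples xs k)) ⟩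
    length (filterᵇ (λ v → not (occurs y v) ∧ distinct v) (tuples xs k)) ≡⟨ cong length (filterᵇ-∧ _ distinct (tuples xs k)) ⟩
    length (filterᵇ distinct (filterᵇ (λ v → not (occurs y v)) (tuples xs k)))
                                                                       ≡⟨ cong (length ∘ filterᵇ distinct) (tuples-avoiding y xs k) ⟩
    length (filterᵇ distinct (tuples (remove y xs) k))                  ≡⟨ count-distinct k (remove y xs) (UniqueP.filter⁺ _ xs!) ⟩
    falling (length (remove y xs)) k                                    ≡⟨ cong (λ m → falling m k) (remove-length xs xs! y∈) ⟩
    falling (length xs ∸ 1) k                                           ∎

symGroup-size : ∀ d → length (symGroup d) ≡ d !
symGroup-size d = begin
  length (filterᵇ isBijection (tuples (allFin d) d)) ≡⟨ cong length (filterᵇ-cong isBijection≡distinct (tuples (allFin d) d)) ⟩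
  length (filterᵇ distinct (tuples (allFin d) d))    ≡⟨ count-distinct d (allFin d) (UniqueP.allFin⁺ d) ⟩
  falling (length (allFin d)) d                      ≡⟨ cong (λ m → falling m d) (ListP.length-tabulate {n = d} (λ x → x)) ⟩
  falling d d                                        ≡⟨ falling-! d ⟩
  d !                                                ∎
  where open ≡-Reasoning

module SymmetricGroup (d : ℕ) where

  S : List (Perm d)
  S = symGroup d

  ∈S⇒Injective : ∀ {σ} → σ ∈ S → Injective σ
  ∈S⇒Injective {σ} σ∈ = isBijection⇒Injective σ (T⇒≡true (proj₂ (∈-filter⁻ (T? ∘ isBijection) {xs = tuples (allFin d) d} σ∈)))

  Injective⇒∈S : ∀ {σ} → Injective σ → σ ∈ S
  Injective⇒∈S {σ} σ-inj = ∈-filter⁺ (T? ∘ isBijection) (tuples-complete d σ) (subst T (sym (Injective⇒isBijection σ σ-inj)) _)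

  S-unique : Unique S
  S-unique = UniqueP.filter⁺ (T? ∘ isBijection) (tuples-unique d (UniqueP.allFin⁺ d))

  _·_ : Perm d → Perm d → Perm d
  σ · τ = tabulate (λ j → lookup τ (lookup σ j))

  lookup-· : ∀ σ τ j → lookup (σ · τ) j ≡ lookup τ (lookup σ j)
  lookup-· σ τ j = VecP.lookup∘tabulate _ j

  perm-ext : ∀ {σ τ : Perm d} → (∀ j → lookup σ j ≡ lookup τ j) → σ ≡ τ
  perm-ext {σ} {τ} σ≗τ = trans (sym (VecP.tabulate∘lookup σ)) (trans (VecP.tabulate-cong σ≗τ) (VecP.tabulate∘lookup τ))

  module _ {ρ : Perm d} (ρ-inj : Injective ρ) where
    ρ⁻¹ : Fin d → Fin d
    ρ⁻¹ j = proj₁ (injective⇒surjective (lookup ρ) ρ-inj j)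

    ρρ⁻¹ : ∀ j → lookup ρ (ρ⁻¹ j) ≡ j
    ρρ⁻¹ j = proj₂ (injective⇒surjective (lookup ρ) ρ-inj j)

    ρ⁻¹ρ : ∀ j → ρ⁻¹ (lookup ρ j) ≡ j
    ρ⁻¹ρ j = ρ-inj (ρρ⁻¹ (lookup ρ j))

    ρ·-injective : ∀ {σ τ} → ρ · σ ≡ ρ · τ → σ ≡ τ
    ρ·-injective {σ} {τ} e = perm-ext λ j → begin
      lookup σ j                    ≡⟨ cong (lookup σ) (sym (ρρ⁻¹ j)) ⟩
      lookup σ (lookup ρ (ρ⁻¹ j))   ≡⟨ sym (lookup-· ρ σ (ρ⁻¹ j)) ⟩
      lookup (ρ · σ) (ρ⁻¹ j)        ≡⟨ cong (λ π → lookup π (ρ⁻¹ j)) e ⟩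
      lookup (ρ · τ) (ρ⁻¹ j)        ≡⟨ lookup-· ρ τ (ρ⁻¹ j) ⟩
      lookup τ (lookup ρ (ρ⁻¹ j))   ≡⟨ cong (lookup τ) (ρρ⁻¹ j) ⟩
      lookup τ j                    ∎
      where open ≡-Reasoning

    ρ·S↭S : map (ρ ·_) S ↭ S
    ρ·S↭S = unique-↭ (UniqueP.map⁺ ρ·-injective S-unique) S-unique into onto
      where
      into : ∀ {π} → π ∈ map (ρ ·_) S → π ∈ S
      into π∈ with ∈-map⁻ (ρ ·_) π∈
      ... | σ , σ∈ , refl = Injective⇒∈S {ρ · σ} λ {a} {b} e →
        ρ-inj (∈S⇒Injective σ∈ (trans (sym (lookup-· ρ σ a)) (trans e (lookup-· ρ σ b))))
      onto : ∀ {τ} → τ ∈ S → τ ∈ map (ρ ·_) S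
      onto {τ} τ∈ = subst (_∈ map (ρ ·_) S) ρ·σ≡τ (∈-map⁺ (ρ ·_) (Injective⇒∈S {σ} σ-inj))
        where
        σ = tabulate (λ j → lookup τ (ρ⁻¹ j))
        σ-inj : Injective σ
        σ-inj {a} {b} e = trans (sym (ρρ⁻¹ a)) (trans (cong (lookup ρ)
          (∈S⇒Injective τ∈ (trans (sym (VecP.lookup∘tabulate _ a)) (trans e (VecP.lookup∘tabulate _ b))))) (ρρ⁻¹ b))
        ρ·σ≡τ : ρ · σ ≡ τ
        ρ·σ≡τ = perm-ext λ j → trans (lookup-· ρ σ j)
                  (trans (VecP.lookup∘tabulate _ (lookup ρ j)) (cong (lookup τ) (ρ⁻¹ρ j)))

  Σ-product : ∀ n′ (G : Perm d → ℚ) →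
    Σ (tuples S (suc n′)) (λ σs → G (tabulate (product σs))) ≡ ℕtoℚ (length S ^ n′) * Σ S G
  Σ-product zero G = begin
    Σ (concatMap (λ ρ → map (ρ ∷ᵥ_) (tuples S 0)) S) F   ≡⟨ Σ-concatMap _ S F ⟩
    Σ S (λ ρ → F (ρ ∷ᵥ []ᵥ) + 0ℚ)                        ≡⟨ Σ-cong S (λ ρ → trans (+-identityʳ _) (cong G (VecP.tabulate∘lookup ρ))) ⟩
    Σ S G                                                ≡⟨ sym (*-identityˡ _) ⟩
    1ℚ * Σ S G                                           ∎
    where
    open ≡-Reasoning
    F = λ (σs : Vec (Perm d) 1) → G (tabulate (product σs))
  Σ-product (suc n′) G = begin
    Σ (concatMap (λ ρ → map (ρ ∷ᵥ_) rest) S) F                   ≡⟨ Σ-concatMap _ S F ⟩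
    Σ S (λ ρ → Σ (map (ρ ∷ᵥ_) rest) F)                           ≡⟨ Σ-cong S (λ ρ → Σ-map (ρ ∷ᵥ_) rest F) ⟩
    Σ S (λ ρ → Σ rest (λ σs → F (ρ ∷ᵥ σs)))                      ≡⟨ Σ-cong S (λ ρ → Σ-cong rest (λ σs → cong G (peel ρ σs))) ⟩
    Σ S (λ ρ → Σ rest (λ σs → G (ρ · tabulate (product σs))))    ≡⟨ Σ-cong S (λ ρ → Σ-product n′ (G ∘ (ρ ·_))) ⟩
    Σ S (λ ρ → ℕtoℚ (length S ^ n′) * Σ S (G ∘ (ρ ·_)))          ≡⟨ Σ-congIn S (λ ρ∈ → cong (ℕtoℚ (length S ^ n′) *_) (reindex ρ∈)) ⟩
    Σ S (λ ρ → ℕtoℚ (length S ^ n′) * Σ S G)                     ≡⟨ Σ-const S _ ⟩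
    ℕtoℚ (length S) * (ℕtoℚ (length S ^ n′) * Σ S G)             ≡⟨ sym (*-assoc (ℕtoℚ (length S)) _ _) ⟩
    (ℕtoℚ (length S) * ℕtoℚ (length S ^ n′)) * Σ S G             ≡⟨ cong (_* Σ S G) (sym (ℕtoℚ-* (length S) (length S ^ n′))) ⟩
    ℕtoℚ (length S ^ suc n′) * Σ S G                             ∎
    where
    open ≡-Reasoning
    rest = tuples S (suc n′)
    F = λ (σs : Vec (Perm d) (suc (suc n′))) → G (tabulate (product σs))
    peel : ∀ ρ σs → tabulate (product (ρ ∷ᵥ σs)) ≡ ρ · tabulate (product σs)
    peel ρ σs = VecP.tabulate-cong (λ j → sym (VecP.lookup∘tabulate (product σs) (lookup ρ j)))
    reindex : ∀ {ρ} → ρ ∈ S → Σ S (G ∘ (ρ ·_)) ≡ Σ S G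
    reindex {ρ} ρ∈ = trans (sym (Σ-map (ρ ·_) S G)) (Σ-↭ G (ρ·S↭S {ρ} (∈S⇒Injective ρ∈)))

average-over-labelings : ∀ n′ d k → dMatchingPoly (suc n′) d k ≡ cycleFormula (suc n′) d k
average-over-labelings n′ d k = begin
  dMatchingPoly n d k
    ≡⟨ cong₂ _*_ (cong inv (trans (length-tuples S n) (cong (_^ n) (symGroup-size d))))
                 (trans (sumP-coeff (map coverPoly labs) k) (Σ-map coverPoly labs (λ p → p k))) ⟩
  inv ((d !) ^ n) * Σ labs (λ lab → coverPoly lab k)
    ≡⟨ cong (inv ((d !) ^ n) *_) (Σ-congIn labs cover) ⟩
  inv ((d !) ^ n) * Σ labs (λ lab → G (tabulate (product lab)))
    ≡⟨ cong (inv ((d !) ^ n) *_) (trans (Σ-product n′ G) (cong (λ s → ℕtoℚ (s ^ n′) * Σ S G) (symGroup-size d))) ⟩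
  inv (d ! ℕ.* (d !) ^ n′) * (ℕtoℚ ((d !) ^ n′) * Σ S G)
    ≡⟨ inv-cancel (d !) ((d !) ^ n′) {{ℕP._!≢0 d}} {{ℕP.m^n≢0 (d !) n′ {{ℕP._!≢0 d}}}} (Σ S G) ⟩
  inv (d !) * Σ S G
    ≡⟨ cong (inv (d !) *_) (sym (trans (sumP-coeff (map (cycleProduct n) S) k) (Σ-map (cycleProduct n) S (λ p → p k)))) ⟩
  cycleFormula n d k ∎
  where
  open ≡-Reasoning
  open SymmetricGroup d
  n = suc n′
  labs = labelings n d
  G = λ σ → cycleProduct n σ k
  cover : ∀ {lab} → lab ∈ labs → coverPoly lab k ≡ G (tabulate (product lab))
  cover {lab} lab∈ = CoverDecomposition.cover-matchingPoly lab (λ i → ∈S⇒Injective (tuples-entries S n lab∈ i)) k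

proposition3p5 : (n d : ℕ) → n ≥ 1 → d ≥ 1 →
  (k : ℕ) → dMatchingPoly n d k ≡ cycleFormula n d k
proposition3p5 (suc n′) d _ _ k = average-over-labelings n′ d k
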